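{- Let $(i_1,\ldots,i_n)\in \mathbb{N}^n$, such that $1i_1+\ldots+ni_n=n$. If $i_n=1$ (and, therefore, $i_1=\ldots=i_{n-1}=0$), then $a_{i_1,\ldots,i_n}=-1$. Otherwise, $i_n=0$ and \[a_{i_1,\ldots,i_n}=\sum_{j\geq 2,\: i_j \geq 1}(i_{j-1}+1)a_{i_1,\ldots,i_{j-1}+1,i_j-1,\ldots,i_{n-1}} -(n-1)\delta_{i_1\geq 1}a_{i_1-1,i_2,\ldots,i_{n-1}},\] where the symbol $\delta_{i_1\geq 1}$ takes the value 1 if $i_1\geq 1$ and $0$ if $i_1=0$.
   Context: $H_{CK}$ is the Connes-Kreimer Hopf algebra over a field $\mathbb{K}$ of characteristic zero: its basis is the set of rooted forests, its commutative product is disjoint union, its coproduct separates forests by admissible cuts, and $S$ is its antipode. It carries a preLie product by grafting: for rooted forests $F,G$, $F\bullet G=\sum_{v\in V(F)}F\bullet_v G$, where $F\bullet_v G$ is obtained from $FG$ by adding an edge from $v$ to every root of $G$. Let $\circ$ denote the rooted tree with a single vertex. Define $\delta_1=\circ$ and $\delta_n=\delta_{n-1}\bullet \circ$ for $n\geq 2$; these generate the Connes-Moscovici Hopf subalgebra $H_{CM}$. For each $n\geq1$ write \[S(\delta_n)=\sum_{\substack{(i_1,\ldots,i_n)\in\mathbb{N}^n,\\ 1i_1+\ldots+ni_n=n}}a_{i_1,\ldots,i_n}\delta_1^{i_1}\ldots\delta_n^{i_n},\] which defines the coefficients $a_{i_1,\ldots,i_n}$. -}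

module Defs where

open import Data.Bool using (Bool; true; false; if_then_else_; _∧_; not)
import Data.Bool as Bool
open import Data.Nat using (ℕ; zero; suc; _+_; _*_; _≟_; pred)
open import Data.Integer using (+_)
open import Data.Rational using (ℚ; 0ℚ; 1ℚ; _/_; -_) renaming (_+_ to _+ℚ_; _*_ to _*ℚ_; _-_ to _-ℚ_)
open import Data.List using (List; []; _∷_; _++_; map; concat; concatMap; foldr; upTo; allFin; filter)
open import Data.List.Properties using (≡-dec)
open import Data.Vec using (Vec; []; _∷_; lookup; updateAt)
open import Data.Fin using (Fin; zero; suc; inject₁)
open import Data.Product using (_×_; _,_)
open import Relation.Binary.PropositionalEquality using (_≡_)
open import Relation.Nullary using (does)

-- A (planar representative of a) rooted tree is a root
-- together with the list of its children subtrees; a forest is a list of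
-- trees.  Non-planarity is taken into account through the canonical code
-- below: two planar forests represent the same rooted forest iff they
-- have the same canonical code.

data Tree : Set where
  node : List Tree → Tree

Forest : Set
Forest = List Tree

leaf : Tree
leaf = node []

mutual
  sizeT : Tree → ℕ
  sizeT (node ts) = suc (sizeF ts)

  sizeF : Forest → ℕ
  sizeF []       = 0
  sizeF (t ∷ ts) = sizeT t + sizeF ts

leqCode : List Bool → List Bool → Bool
leqCode []       _        = true
leqCode (_ ∷ _)  []       = false
leqCode (x ∷ xs) (y ∷ ys) = if does (x Bool.≟ y) then leqCode xs ys else (not x ∧ y)

insertCode : List Bool → List (List Bool) → List (List Bool)
insertCode w []       = w ∷ []
insertCode w (v ∷ vs) = if leqCode w v then w ∷ v ∷ vs else v ∷ insertCode w vs

sortCodes : List (List Bool) → List (List Bool)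
sortCodes = foldr insertCode []

mutual
  codeT : Tree → List Bool
  codeT (node ts) = true ∷ (codeF ts ++ (false ∷ []))

  codesF : Forest → List (List Bool)
  codesF []       = []
  codesF (t ∷ ts) = codeT t ∷ codesF ts

  codeF : Forest → List Bool
  codeF ts = concat (sortCodes (codesF ts))

-- Elements of H_CK (over ℚ): finite formal ℚ-linear combinations of forests.

LinComb : Set
LinComb = List (ℚ × Forest)

sumℚ : List ℚ → ℚ
sumℚ = foldr _+ℚ_ 0ℚ

coeff : List Bool → LinComb → ℚ
coeff w []            = 0ℚ
coeff w ((c , F) ∷ x) =
  if does (≡-dec Bool._≟_ (codeF F) w) then c +ℚ coeff w x else coeff w x

infix 4 _≈_
_≈_ : LinComb → LinComb → Set
x ≈ y = ∀ (w : List Bool) → coeff w x ≡ coeff w y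

zeroL : LinComb
zeroL = []

oneL : LinComb
oneL = (1ℚ , []) ∷ []

forestL : Forest → LinComb
forestL F = (1ℚ , F) ∷ []

scale : ℚ → LinComb → LinComb
scale c = map (λ { (d , F) → (c *ℚ d , F) })

negL : LinComb → LinComb
negL = scale (- 1ℚ)

addL : LinComb → LinComb → LinComb
addL = _++_

mulL : LinComb → LinComb → LinComb
mulL x y = concatMap (λ { (c , F) → map (λ { (d , G) → (c *ℚ d , F ++ G) }) y }) x

powL : LinComb → ℕ → LinComb
powL x zero    = oneL
powL x (suc k) = mulL x (powL x k)

mutual
  graftT : Tree → Forest → List Tree
  graftT (node ts) G = node (ts ++ G) ∷ map node (graftF ts G)

  graftF : Forest → Forest → List Forest
  graftF []       G = []
  graftF (t ∷ ts) G = map (_∷ ts) (graftT t G) ++ map (t ∷_) (graftF ts G)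

graftL : LinComb → LinComb → LinComb
graftL x y =
  concatMap (λ { (c , F) → concatMap (λ { (d , G) → map (λ H → (c *ℚ d , H)) (graftF F G) }) y }) x

-- δ k  is  δ_{k+1}  :  δ_1 = ∘ ,  δ_{n} = δ_{n-1} • ∘
δ : ℕ → LinComb
δ zero    = forestL (leaf ∷ [])
δ (suc k) = graftL (δ k) (forestL (leaf ∷ []))

-- A cut of a forest F is a pair (P , R), P the pruned
-- part (a set of vertices closed under taking descendants), R the remaining
-- part (containing the roots);  Δ F = Σ_{cuts} P ⊗ R  (including the empty
-- cut  1 ⊗ F  and the total cut  F ⊗ 1).

mutual
  cutsT : Tree → List (Forest × Forest)
  cutsT (node ts) =
    (node ts ∷ [] , []) ∷ map (λ { (P , R) → (P , node R ∷ []) }) (cutsF ts)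

  cutsF : Forest → List (Forest × Forest)
  cutsF []       = ([] , []) ∷ []
  cutsF (t ∷ ts) =
    concatMap (λ { (P₁ , R₁) → map (λ { (P₂ , R₂) → (P₁ ++ P₂ , R₁ ++ R₂) }) (cutsF ts) }) (cutsT t)

εL : Forest → LinComb
εL []      = oneL
εL (_ ∷ _) = zeroL

-- Antipode, defined by the antipode axiom  m ∘ (S ⊗ id) ∘ Δ = η ∘ ε ,
-- i.e.  S(F) = ε(F) - Σ_{cuts (P,R), R ≠ 1} S(P) R .
-- The first argument is fuel; S F = antipodeF (sizeF F) F  (every P with
-- R ≠ 1 has fewer vertices than F).

antipodeF : ℕ → Forest → LinComb
antipodeF zero    F = εL F
antipodeF (suc k) F =
  addL (εL F)
       (negL (concatMap (λ { (P , []) → zeroL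
                           ; (P , R@(_ ∷ _)) → mulL (antipodeF k P) (forestL R) })
                        (cutsF F)))

S : LinComb → LinComb
S = concatMap (λ { (c , F) → scale c (antipodeF (sizeF F) F) })

wsFrom : ∀ {n} → ℕ → Vec ℕ n → ℕ
wsFrom j []       = 0
wsFrom j (x ∷ xs) = j * x + wsFrom (suc j) xs

ws : ∀ {n} → Vec ℕ n → ℕ
ws = wsFrom 1

allVecs : ℕ → (n : ℕ) → List (Vec ℕ n)
allVecs b zero    = [] ∷ []
allVecs b (suc n) = concatMap (λ x → map (x ∷_) (allVecs b n)) (upTo (suc b))

tuples : (n : ℕ) → List (Vec ℕ n)
tuples n = filter (λ v → ws v ≟ n) (allVecs n n)

monoFrom : ∀ {n} → ℕ → Vec ℕ n → LinComb
monoFrom k []       = oneL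
monoFrom k (x ∷ xs) = mulL (powL (δ k) x) (monoFrom (suc k) xs)

mono : ∀ {n} → Vec ℕ n → LinComb
mono = monoFrom 0

expansion : (n : ℕ) → (Vec ℕ n → ℚ) → LinComb
expansion n a = concatMap (λ i → scale (a i) (mono i)) (tuples n)

-- Right-hand side of the recursion, for v = (i_1,…,i_{n-1}) and
-- b = a_{(n-1)} (coefficients of S(δ_{n-1})).

ifPos : ℕ → ℚ → ℚ
ifPos zero    q = 0ℚ
ifPos (suc _) q = q

natℚ : ℕ → ℚ
natℚ k = + k / 1

-- Σ_{j ≥ 2, i_j ≥ 1} (i_{j-1}+1) a_{i_1,…,i_{j-1}+1,i_j-1,…,i_{n-1}}
-- (position j is  suc k , position j-1 is  inject₁ k , 0-indexed)
jsum : ∀ {m} → (Vec ℕ m → ℚ) → Vec ℕ m → ℚ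
jsum {zero}  b v = 0ℚ
jsum {suc m} b v = sumℚ (map term (allFin m))
  where
  term : Fin m → ℚ
  term k = ifPos (lookup v (suc k))
                 ((natℚ (lookup v (inject₁ k)) +ℚ 1ℚ)
                   *ℚ b (updateAt (updateAt v (inject₁ k) suc) (suc k) pred))

firstTerm : ∀ {m} → (Vec ℕ m → ℚ) → Vec ℕ m → ℚ
firstTerm b []            = 0ℚ
firstTerm b (zero  ∷ xs)  = 0ℚ
firstTerm b (suc x ∷ xs)  = b (x ∷ xs)

-- full right-hand side, with n - 1 = m
recRHS : (m : ℕ) → (Vec ℕ m → ℚ) → Vec ℕ m → ℚ
recRHS m b v = jsum b v -ℚ (natℚ m *ℚ firstTerm b v)

{-# OPTIONS --safe #-}
-- Kill every forest that contains a tree other than a corolla c_k = B⁺(∘ᵏ).  This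
-- projection is multiplicative and sends δ_{k+1} to c_k, so the monomials δ^i go to
-- distinct monomials c^i and a_i is the coefficient of c^i in the projection of S(δ_n).
-- Two properties of S survive the projection.  S is multiplicative, and grafting a
-- leaf, N x = x • ∘, satisfies Δ(N x) = (N ⊗ id + id ⊗ N) Δ x + Σ |R| ∘ P ⊗ R, so the
-- antipode axiom gives S(N F) = N S(F) − |F| ∘ S(F).  On corolla monomials N is the
-- derivation c_k ↦ c_{k+1}; comparing coefficients of c^i in
-- S(δ_n) = N S(δ_{n-1}) − (n − 1) c_0 S(δ_{n-1}) gives the recursion.
module Submission where

open import Algebra.Bundles using (CommutativeMonoid)
import Algebra.Properties.CommutativeSemigroup as CommSemigroupProperties
import Algebra.Properties.Group as GroupProperties
import Algebra.Properties.Ring as RingProperties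
open import Data.Bool using (Bool; true; false; if_then_else_; T) renaming (_≟_ to _≟ᵇ_)
open import Data.Empty using (⊥-elim)
import Data.Fin as Fin
import Data.Integer as ℤ
import Data.Integer.Properties as ℤ
open import Data.List using (List; []; _∷_; _++_; map; concat; concatMap; drop; filter; length; upTo; tabulate; allFin)
import Data.List.Properties as List
open import Data.List.Properties using (≡-dec)
open import Data.List.Relation.Binary.Permutation.Propositional as Perm using (_↭_; ↭-refl; ↭-prep; ↭-swap; ↭-trans)
open import Data.List.Relation.Binary.Permutation.Propositional.Properties using (↭-length)
open import Data.List.Relation.Unary.All as ListAll using ([]; _∷_) renaming (All to ListAll)
import Data.List.Relation.Unary.All.Properties as ListAll
open import Data.Maybe as Maybe using (Maybe; just; nothing; _>>=_)
import Data.Maybe.Properties as Maybe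
open import Data.Nat as ℕ using (ℕ; zero; suc; pred; _≤_; _<_; z≤n; s≤s)
import Data.Nat.Properties as ℕ
import Data.Nat.Solver as ℕSolver
open import Data.Product using (_×_; _,_; proj₂; uncurry; map₂; Σ-syntax)
open import Data.Rational using (ℚ; 0ℚ; 1ℚ; _+_; _*_; _-_; -_; toℚᵘ)
import Data.Rational.Properties as ℚ
open import Data.Rational.Solver using (module +-*-Solver)
import Data.Rational.Unnormalised as ℚᵘ
import Data.Rational.Unnormalised.Properties as ℚᵘ
open import Data.Sum using (_⊎_; inj₁; inj₂)
open import Data.Unit using (tt)
open import Data.Vec using (Vec; []; _∷_; _∷ʳ_; zipWith; replicate; init; last; initLast)
open import Data.Vec.Relation.Binary.Pointwise.Inductive
  using (Pointwise; []; _∷_; Pointwise-≡⇒≡; zipWith-assoc; zipWith-comm; zipWith-identityˡ; zipWith-identityʳ)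
open import Data.Vec.Relation.Unary.All as VecAll using (All)
open import Function using (_∘_; id)
open import Relation.Binary.PropositionalEquality
open import Relation.Nullary using (Dec; does; yes; no)

open import Defs

private
  variable
    A B : Set

module ℚ+ = CommSemigroupProperties (CommutativeMonoid.commutativeSemigroup ℚ.+-0-commutativeMonoid)
module ℕ+ = CommSemigroupProperties ℕ.+-commutativeSemigroup
module ℚ* = CommSemigroupProperties (CommutativeMonoid.commutativeSemigroup ℚ.*-1-commutativeMonoid)
module ℚ-ring = RingProperties ℚ.+-*-ring
module ℚ-group = GroupProperties ℚ.+-0-group

sumBy : List A → (A → ℚ) → ℚ
sumBy xs f = sumℚ (map f xs)

sumBy-++ : ∀ (xs ys : List A) f → sumBy (xs ++ ys) f ≡ sumBy xs f + sumBy ys f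
sumBy-++ []       ys f = sym (ℚ.+-identityˡ _)
sumBy-++ (x ∷ xs) ys f = trans (cong (f x +_) (sumBy-++ xs ys f)) (sym (ℚ.+-assoc (f x) _ _))

sumBy-cong : ∀ (xs : List A) {f g} → (∀ x → f x ≡ g x) → sumBy xs f ≡ sumBy xs g
sumBy-cong xs f≗g = cong sumℚ (List.map-cong f≗g xs)

sumBy-cong-All : ∀ {P : A → Set} {xs f g} → ListAll P xs → (∀ {x} → P x → f x ≡ g x) → sumBy xs f ≡ sumBy xs g
sumBy-cong-All ps f≗g = cong sumℚ (List.map-cong-local (ListAll.map f≗g ps))

sumBy-zero : ∀ (xs : List A) {f} → (∀ x → f x ≡ 0ℚ) → sumBy xs f ≡ 0ℚ
sumBy-zero []       f≡0 = refl
sumBy-zero (x ∷ xs) f≡0 = trans (cong₂ _+_ (f≡0 x) (sumBy-zero xs f≡0)) (ℚ.+-identityˡ 0ℚ)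

sumBy-+ : ∀ (xs : List A) f g → sumBy xs (λ x → f x + g x) ≡ sumBy xs f + sumBy xs g
sumBy-+ []       f g = sym (ℚ.+-identityˡ 0ℚ)
sumBy-+ (x ∷ xs) f g = trans (cong (f x + g x +_) (sumBy-+ xs f g)) (ℚ+.interchange (f x) (g x) _ _)

sumBy-*ˡ : ∀ c (xs : List A) f → sumBy xs (λ x → c * f x) ≡ c * sumBy xs f
sumBy-*ˡ c []       f = sym (ℚ.*-zeroʳ c)
sumBy-*ˡ c (x ∷ xs) f = trans (cong (c * f x +_) (sumBy-*ˡ c xs f)) (sym (ℚ.*-distribˡ-+ c (f x) _))

sumBy-neg : ∀ (xs : List A) f → sumBy xs (λ x → - f x) ≡ - sumBy xs f
sumBy-neg []       f = refl
sumBy-neg (x ∷ xs) f = trans (cong (- f x +_) (sumBy-neg xs f)) (sym (ℚ.neg-distrib-+ (f x) _))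

sumBy-map : ∀ (g : A → B) xs f → sumBy (map g xs) f ≡ sumBy xs (f ∘ g)
sumBy-map g xs f = cong sumℚ (sym (List.map-∘ xs))

sumBy-concatMap : ∀ (g : A → List B) xs f → sumBy (concatMap g xs) f ≡ sumBy xs (λ x → sumBy (g x) f)
sumBy-concatMap g []       f = refl
sumBy-concatMap g (x ∷ xs) f =
  trans (sumBy-++ (g x) (concatMap g xs) f) (cong (sumBy (g x) f +_) (sumBy-concatMap g xs f))

sumBy-swap : ∀ (xs : List A) (ys : List B) (f : A → B → ℚ) →
             sumBy xs (λ x → sumBy ys (f x)) ≡ sumBy ys (λ y → sumBy xs (λ x → f x y))
sumBy-swap []       ys f = sym (sumBy-zero ys (λ _ → refl))
sumBy-swap (x ∷ xs) ys f = trans (cong (sumBy ys (f x) +_) (sumBy-swap xs ys f)) (sym (sumBy-+ ys (f x) _))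

sumBy-sub-*ˡ : ∀ (xs : List A) f c g → sumBy xs (λ x → f x - c * g x) ≡ sumBy xs f - c * sumBy xs g
sumBy-sub-*ˡ xs f c g = trans (sumBy-+ xs f _) (cong (sumBy xs f +_) (trans (sumBy-neg xs _) (cong -_ (sumBy-*ˡ c xs g))))

sumBy-filter : ∀ {P : A → Set} (P? : ∀ x → Dec (P x)) xs (f : A → ℚ) →
  sumBy (filter P? xs) f ≡ sumBy xs (λ x → if does (P? x) then f x else 0ℚ)
sumBy-filter P? []       f = refl
sumBy-filter P? (x ∷ xs) f with does (P? x)
... | true  = cong (f x +_) (sumBy-filter P? xs f)
... | false = trans (sumBy-filter P? xs f) (sym (ℚ.+-identityˡ _))

sumBy-*-swap : ∀ (xs : List A) (ys : List (ℚ × B)) (c : A → ℚ) (f : A → B → ℚ) →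
  sumBy xs (λ x → c x * sumBy ys (λ (d , y) → d * f x y)) ≡ sumBy ys (λ (d , y) → d * sumBy xs (λ x → c x * f x y))
sumBy-*-swap xs ys c f = begin
  sumBy xs (λ x → c x * sumBy ys (λ (d , y) → d * f x y))
    ≡⟨ sumBy-cong xs (λ x → sym (sumBy-*ˡ (c x) ys _)) ⟩
  sumBy xs (λ x → sumBy ys (λ (d , y) → c x * (d * f x y)))
    ≡⟨ sumBy-swap xs ys _ ⟩
  sumBy ys (λ (d , y) → sumBy xs (λ x → c x * (d * f x y)))
    ≡⟨ sumBy-cong ys (λ (d , y) → trans (sumBy-cong xs (λ x → ℚ*.x∙yz≈y∙xz (c x) d (f x y))) (sumBy-*ˡ d xs _)) ⟩
  sumBy ys (λ (d , y) → d * sumBy xs (λ x → c x * f x y)) ∎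
  where open ≡-Reasoning

natℚ-+ : ∀ m n → natℚ (m ℕ.+ n) ≡ natℚ m + natℚ n
natℚ-+ m n = ℚ.toℚᵘ-injective (ℚᵘ.≃-trans (toℚᵘ-natℚ (m ℕ.+ n)) (ℚᵘ.≃-sym
  (ℚᵘ.≃-trans (ℚ.toℚᵘ-homo-+ (natℚ m) (natℚ n))
  (ℚᵘ.≃-trans (ℚᵘ.+-cong (toℚᵘ-natℚ m) (toℚᵘ-natℚ n)) sum≃))))
  where
  toℚᵘ-natℚ : ∀ k → toℚᵘ (natℚ k) ℚᵘ.≃ ℚᵘ.mkℚᵘ (ℤ.+ k) 0
  toℚᵘ-natℚ k = ℚ.toℚᵘ-fromℚᵘ (ℚᵘ.mkℚᵘ (ℤ.+ k) 0)
  sum≃ : ℚᵘ.mkℚᵘ (ℤ.+ m) 0 ℚᵘ.+ ℚᵘ.mkℚᵘ (ℤ.+ n) 0 ℚᵘ.≃ ℚᵘ.mkℚᵘ (ℤ.+ (m ℕ.+ n)) 0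
  sum≃ = ℚᵘ.*≡* (cong (ℤ._* ℤ.1ℤ) (cong₂ ℤ._+_ (ℤ.*-identityʳ (ℤ.+ m)) (ℤ.*-identityʳ (ℤ.+ n))))

natℚ-suc : ∀ x → natℚ (suc x) ≡ natℚ x + 1ℚ
natℚ-suc x = trans (cong natℚ (ℕ.+-comm 1 x)) (natℚ-+ x 1)

natℚ-suc-* : ∀ n a → natℚ (suc n) * a ≡ a + natℚ n * a
natℚ-suc-* n a = trans (cong (_* a) (natℚ-+ 1 n))
  (trans (ℚ.*-distribʳ-+ a 1ℚ (natℚ n)) (cong (_+ natℚ n * a) (ℚ.*-identityˡ a)))

natℚ-*-cong-suc : ∀ x {a b} → (∀ k → x ≡ suc k → a ≡ b) → natℚ x * a ≡ natℚ x * b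
natℚ-*-cong-suc zero    {a} {b} _ = trans (ℚ.*-zeroˡ a) (sym (ℚ.*-zeroˡ b))
natℚ-*-cong-suc (suc x) a≡b = cong (natℚ (suc x) *_) (a≡b x refl)

data NonEmpty {A : Set} : List A → Set where
  nonEmpty : ∀ {x xs} → NonEmpty (x ∷ xs)

sizeF-++ : ∀ F G → sizeF (F ++ G) ≡ sizeF F ℕ.+ sizeF G
sizeF-++ []      G = refl
sizeF-++ (t ∷ F) G = trans (cong (sizeT t ℕ.+_) (sizeF-++ F G)) (sym (ℕ.+-assoc (sizeT t) _ _))

nonEmpty-++ : ∀ {xs ys : List A} → NonEmpty xs → NonEmpty (xs ++ ys)
nonEmpty-++ nonEmpty = nonEmpty

sizeF-nonEmpty : ∀ {R : Forest} → NonEmpty R → 1 ≤ sizeF R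
sizeF-nonEmpty {node _ ∷ _} nonEmpty = s≤s z≤n

IsCut : Forest → Forest × Forest → Set
IsCut F (P , R) = sizeF P ℕ.+ sizeF R ≡ sizeF F

IsTrunkCut : Forest → Forest × Forest → Set
IsTrunkCut F c = IsCut F c × NonEmpty (proj₂ c)

trunkCuts : Forest → List (Forest × Forest)
trunkCuts F = drop 1 (cutsF F)

cutsF-total : ∀ F → cutsF F ≡ (F , []) ∷ trunkCuts F
cutsF-total []             = refl
cutsF-total (node us ∷ ts) rewrite cutsF-total ts = refl

All-concatMap⁺ : ∀ {P : B → Set} (f : A → List B) {xs} → ListAll (ListAll P ∘ f) xs → ListAll P (concatMap f xs)
All-concatMap⁺ f = ListAll.concat⁺ ∘ ListAll.map⁺

mutual
  cutsT-isCut : ∀ t → ListAll (IsCut (t ∷ [])) (cutsT t)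
  cutsT-isCut (node us) =
    cong suc (ℕ.+-identityʳ _) ∷ ListAll.map⁺ (ListAll.map (λ { {P , R} e → trunk P R e }) (cutsF-isCut us))
    where
    trunk : ∀ P R → sizeF P ℕ.+ sizeF R ≡ sizeF us → sizeF P ℕ.+ (suc (sizeF R) ℕ.+ 0) ≡ suc (sizeF us) ℕ.+ 0
    trunk P R e rewrite ℕ.+-identityʳ (sizeF R) | ℕ.+-identityʳ (sizeF us) = trans (ℕ.+-suc (sizeF P) _) (cong suc e)

  cutsF-isCut : ∀ F → ListAll (IsCut F) (cutsF F)
  cutsF-isCut []       = refl ∷ []
  cutsF-isCut (t ∷ ts) = All-concatMap⁺ _ (ListAll.map (λ { {P₁ , R₁} e₁ →
    ListAll.map⁺ (ListAll.map (λ { {P₂ , R₂} e₂ → pair P₁ R₁ P₂ R₂ e₁ e₂ }) (cutsF-isCut ts)) }) (cutsT-isCut t))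
    where
    pair : ∀ P₁ R₁ P₂ R₂ → IsCut (t ∷ []) (P₁ , R₁) → IsCut ts (P₂ , R₂) → IsCut (t ∷ ts) (P₁ ++ P₂ , R₁ ++ R₂)
    pair P₁ R₁ P₂ R₂ e₁ e₂ rewrite sizeF-++ P₁ P₂ | sizeF-++ R₁ R₂ =
      trans (ℕ+.interchange (sizeF P₁) (sizeF P₂) (sizeF R₁) (sizeF R₂))
            (cong₂ ℕ._+_ (trans e₁ (ℕ.+-identityʳ (sizeT t))) e₂)

trunkCuts-nonEmpty : ∀ F → ListAll (NonEmpty ∘ proj₂) (trunkCuts F)
trunkCuts-nonEmpty []             = []
trunkCuts-nonEmpty (node us ∷ ts) rewrite cutsF-total ts =
  ListAll.++⁺ (ListAll.map⁺ (ListAll.map (λ { {P , R} ne → ne }) (trunkCuts-nonEmpty ts)))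
          (All-concatMap⁺ _ (ListAll.map⁺ (ListAll.universal (λ { (P , R) →
             ListAll.map⁺ (ListAll.universal (λ { (P₂ , R₂) → nonEmpty }) (cutsF ts)) }) (cutsF us))))

trunkCuts-isTrunkCut : ∀ F → ListAll (IsTrunkCut F) (trunkCuts F)
trunkCuts-isTrunkCut F =
  ListAll.zip (ListAll.tail (subst (ListAll (IsCut F)) (cutsF-total F) (cutsF-isCut F)) , trunkCuts-nonEmpty F)

pruned-< : ∀ F P R → IsCut F (P , R) → NonEmpty R → sizeF P < sizeF F
pruned-< F P R e ne = ℕ.<-≤-trans (ℕ.m<m+n (sizeF P) (sizeF-nonEmpty ne)) (ℕ.≤-reflexive e)

antipode : Forest → LinComb
antipode F = antipodeF (sizeF F) F

antipodeF-fuel : ∀ {k k′} F → sizeF F ≤ k → sizeF F ≤ k′ → antipodeF k F ≡ antipodeF k′ F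
antipodeF-fuel {zero}  {zero}   F              _  _  = refl
antipodeF-fuel {zero}  {suc _}  []             _  _  = refl
antipodeF-fuel {suc _} {zero}   []             _  _  = refl
antipodeF-fuel {zero}  {suc _}  (node _ ∷ _)   () _
antipodeF-fuel {suc _} {zero}   (node _ ∷ _)   _  ()
antipodeF-fuel {suc k} {suc k′} F F≤k F≤k′ =
  cong (λ x → addL (εL F) (negL (concat x))) (List.map-cong-local (ListAll.map
    (λ { {P , []} _ → refl
       ; {P , r ∷ R} e → cong (λ x → mulL x (forestL (r ∷ R)))
           (antipodeF-fuel P (pruned≤ P r R e F≤k) (pruned≤ P r R e F≤k′)) })
    (cutsF-isCut F)))
  where
  pruned≤ : ∀ P r R {j} → IsCut F (P , r ∷ R) → sizeF F ≤ suc j → sizeF P ≤ j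
  pruned≤ P r R e F≤j = ℕ.≤-pred (ℕ.<-≤-trans (pruned-< F P (r ∷ R) e nonEmpty) F≤j)

antipodeTerm : ℕ → Forest × Forest → LinComb
antipodeTerm k (P , [])    = zeroL
antipodeTerm k (P , r ∷ R) = mulL (antipodeF k P) (forestL (r ∷ R))

antipodeF-suc : ∀ k F → antipodeF (suc k) F ≡ addL (εL F) (negL (concatMap (antipodeTerm k) (cutsF F)))
antipodeF-suc k F =
  cong (λ x → addL (εL F) (negL x)) (List.concatMap-cong (λ { (P , []) → refl ; (P , r ∷ R) → refl }) (cutsF F))

antipodeF-stable : ∀ {k} F → sizeF F ≤ k → antipodeF k F ≡ antipode F
antipodeF-stable F F≤k = antipodeF-fuel F F≤k ℕ.≤-refl

graftLeaf : Forest → List Forest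
graftLeaf F = graftF F (leaf ∷ [])

graftLeafT : Tree → List Tree
graftLeafT t = graftT t (leaf ∷ [])

sumBy-graftLeaf-∷ : ∀ t ts (h : Forest → ℚ) →
  sumBy (graftLeaf (t ∷ ts)) h ≡ sumBy (graftLeafT t) (λ t′ → h (t′ ∷ ts)) + sumBy (graftLeaf ts) (λ G → h (t ∷ G))
sumBy-graftLeaf-∷ t ts h = trans (sumBy-++ (map (_∷ ts) (graftLeafT t)) _ h)
  (cong₂ _+_ (sumBy-map (_∷ ts) (graftLeafT t) h) (sumBy-map (t ∷_) (graftLeaf ts) h))

sumBy-graftLeafT-node : ∀ ts (h : Tree → ℚ) →
  sumBy (graftLeafT (node ts)) h ≡ h (node (ts ++ leaf ∷ [])) + sumBy (graftLeaf ts) (h ∘ node)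
sumBy-graftLeafT-node ts h = cong (h (node (ts ++ leaf ∷ [])) +_) (sumBy-map node (graftLeaf ts) h)

sumBy-graftLeaf-tree : ∀ t (h : Forest → ℚ) →
  sumBy (graftLeaf (t ∷ [])) h ≡ sumBy (graftLeafT t) (λ t′ → h (t′ ∷ []))
sumBy-graftLeaf-tree t h = trans (sumBy-graftLeaf-∷ t [] h) (ℚ.+-identityʳ _)

sumBy-graftLeaf-++ : ∀ X Y (h : Forest → ℚ) →
  sumBy (graftLeaf (X ++ Y)) h ≡ sumBy (graftLeaf X) (λ G → h (G ++ Y)) + sumBy (graftLeaf Y) (λ G → h (X ++ G))
sumBy-graftLeaf-++ []      Y h = sym (ℚ.+-identityˡ _)
sumBy-graftLeaf-++ (t ∷ X) Y h = begin
  sumBy (graftLeaf (t ∷ X ++ Y)) h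
    ≡⟨ sumBy-graftLeaf-∷ t (X ++ Y) h ⟩
  a + sumBy (graftLeaf (X ++ Y)) (λ G → h (t ∷ G))
    ≡⟨ cong (a +_) (sumBy-graftLeaf-++ X Y (λ G → h (t ∷ G))) ⟩
  a + (b + c)
    ≡⟨ ℚ.+-assoc a b c ⟨
  (a + b) + c
    ≡⟨ cong (_+ c) (sumBy-graftLeaf-∷ t X (λ G → h (G ++ Y))) ⟨
  sumBy (graftLeaf (t ∷ X)) (λ G → h (G ++ Y)) + c ∎
  where
  open ≡-Reasoning
  a b c : ℚ
  a = sumBy (graftLeafT t) (λ t′ → h (t′ ∷ X ++ Y))
  b = sumBy (graftLeaf X) (λ G → h (t ∷ G ++ Y))
  c = sumBy (graftLeaf Y) (λ G → h (t ∷ X ++ G))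

_·_ : Forest × Forest → Forest × Forest → Forest × Forest
(P₁ , R₁) · (P₂ , R₂) = (P₁ ++ P₂ , R₁ ++ R₂)

sumBy-cutsT-node : ∀ X (h : Forest × Forest → ℚ) →
  sumBy (cutsT (node X)) h ≡ h (node X ∷ [] , []) + sumBy (cutsF X) (λ (P , R) → h (P , node R ∷ []))
sumBy-cutsT-node X h = cong (h (node X ∷ [] , []) +_) (sumBy-map _ (cutsF X) h)

sumBy-cutsF-∷ : ∀ t G (h : Forest × Forest → ℚ) →
  sumBy (cutsF (t ∷ G)) h ≡ sumBy (cutsT t) (λ c₁ → sumBy (cutsF G) (λ c₂ → h (c₁ · c₂)))
sumBy-cutsF-∷ t G h = trans (sumBy-concatMap _ (cutsT t) h)
  (sumBy-cong (cutsT t) (λ { (P₁ , R₁) → sumBy-map _ (cutsF G) h }))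

sumBy-cutsF-++ : ∀ F G (h : Forest × Forest → ℚ) →
  sumBy (cutsF (F ++ G)) h ≡ sumBy (cutsF F) (λ c₁ → sumBy (cutsF G) (λ c₂ → h (c₁ · c₂)))
sumBy-cutsF-++ []      G h = sym (ℚ.+-identityʳ _)
sumBy-cutsF-++ (t ∷ F) G h = begin
  sumBy (cutsF (t ∷ F ++ G)) h
    ≡⟨ sumBy-cutsF-∷ t (F ++ G) h ⟩
  sumBy (cutsT t) (λ c₁ → sumBy (cutsF (F ++ G)) (λ c → h (c₁ · c)))
    ≡⟨ sumBy-cong (cutsT t) (λ c₁ → trans (sumBy-cutsF-++ F G _)
         (sumBy-cong (cutsF F) (λ c′ → sumBy-cong (cutsF G) (λ c₂ → cong h (·-assoc c₁ c′ c₂))))) ⟩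
  sumBy (cutsT t) (λ c₁ → sumBy (cutsF F) (λ c′ → sumBy (cutsF G) (λ c₂ → h ((c₁ · c′) · c₂))))
    ≡⟨ sumBy-cutsF-∷ t F _ ⟨
  sumBy (cutsF (t ∷ F)) (λ c₁ → sumBy (cutsF G) (λ c₂ → h (c₁ · c₂))) ∎
  where
  open ≡-Reasoning
  ·-assoc : ∀ c₁ c₂ c₃ → c₁ · (c₂ · c₃) ≡ (c₁ · c₂) · c₃
  ·-assoc (P₁ , R₁) (P₂ , R₂) (P₃ , R₃) = sym (cong₂ _,_ (List.++-assoc P₁ P₂ P₃) (List.++-assoc R₁ R₂ R₃))

LeafInvariant : (Forest → Forest → ℚ) → Set
LeafInvariant f = ∀ X Y R → f (X ++ leaf ∷ Y) R ≡ f (leaf ∷ X ++ Y) R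

LeafInvariant-prefix : ∀ f P₁ R₁ → LeafInvariant f → LeafInvariant (λ P R → f (P₁ ++ P) (R₁ ++ R))
LeafInvariant-prefix f P₁ R₁ inv X Y R = begin
  f (P₁ ++ X ++ leaf ∷ Y) (R₁ ++ R)   ≡⟨ cong (λ P → f P (R₁ ++ R)) (List.++-assoc P₁ X (leaf ∷ Y)) ⟨
  f ((P₁ ++ X) ++ leaf ∷ Y) (R₁ ++ R) ≡⟨ inv (P₁ ++ X) Y (R₁ ++ R) ⟩
  f (leaf ∷ (P₁ ++ X) ++ Y) (R₁ ++ R) ≡⟨ cong (λ P → f (leaf ∷ P) (R₁ ++ R)) (List.++-assoc P₁ X Y) ⟩
  f (leaf ∷ P₁ ++ X ++ Y) (R₁ ++ R)   ≡⟨ inv P₁ (X ++ Y) (R₁ ++ R) ⟨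
  f (P₁ ++ leaf ∷ X ++ Y) (R₁ ++ R)   ∎
  where open ≡-Reasoning

LeafInvariant-suffix : ∀ f P₂ R₂ → LeafInvariant f → LeafInvariant (λ P R → f (P ++ P₂) (R ++ R₂))
LeafInvariant-suffix f P₂ R₂ inv X Y R =
  trans (cong (λ P → f P (R ++ R₂)) (List.++-assoc X (leaf ∷ Y) P₂))
  (trans (inv X (Y ++ P₂) (R ++ R₂)) (cong (λ P → f (leaf ∷ P) (R ++ R₂)) (sym (List.++-assoc X Y P₂))))

LeafInvariant-sumBy : ∀ (xs : List A) (f : A → Forest → Forest → ℚ) →
  (∀ x → LeafInvariant (f x)) → LeafInvariant (λ P R → sumBy xs (λ x → f x P R))
LeafInvariant-sumBy xs f inv X Y R = sumBy-cong xs (λ x → inv x X Y R)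

-- With f P R read as P ⊗ R, summing graftCut f over the cuts of F gives
-- Δ(F • ∘) = (N ⊗ id + id ⊗ N) Δ F + Σ |R| ∘ P ⊗ R, N the grafting of a leaf: the new
-- leaf is pruned with P, stays in R, or is cut off alone from one of the |R| vertices of R.
-- In the last case it lands somewhere inside P, hence the LeafInvariant hypotheses below.
graftCut : (Forest → Forest → ℚ) → Forest × Forest → ℚ
graftCut f (P , R) =
  sumBy (graftLeaf P) (λ P′ → f P′ R) + sumBy (graftLeaf R) (λ R′ → f P R′) + natℚ (sizeF R) * f (leaf ∷ P) R

graftCut-sumBy : ∀ {A : Set} (xs : List A) (f : A → Forest → Forest → ℚ) c →
  graftCut (λ P R → sumBy xs (λ x → f x P R)) c ≡ sumBy xs (λ x → graftCut (f x) c)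
graftCut-sumBy {A} xs f (P , R) = begin
  sumBy (graftLeaf P) (λ P′ → sumBy xs (λ x → f x P′ R)) + sumBy (graftLeaf R) (λ R′ → sumBy xs (λ x → f x P R′))
    + natℚ (sizeF R) * sumBy xs (λ x → f x (leaf ∷ P) R)
    ≡⟨ cong₂ _+_ (cong₂ _+_ (sumBy-swap (graftLeaf P) xs _) (sumBy-swap (graftLeaf R) xs _))
                 (sym (sumBy-*ˡ (natℚ (sizeF R)) xs _)) ⟩
  sumBy xs pruned + sumBy xs trunk + sumBy xs leafCut
    ≡⟨ cong (_+ sumBy xs leafCut) (sumBy-+ xs pruned trunk) ⟨
  sumBy xs (λ x → pruned x + trunk x) + sumBy xs leafCut
    ≡⟨ sumBy-+ xs _ leafCut ⟨
  sumBy xs (λ x → graftCut (f x) (P , R)) ∎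
  where
  open ≡-Reasoning
  pruned trunk leafCut : A → ℚ
  pruned x = sumBy (graftLeaf P) (λ P′ → f x P′ R)
  trunk x = sumBy (graftLeaf R) (λ R′ → f x P R′)
  leafCut x = natℚ (sizeF R) * f x (leaf ∷ P) R

graftCut-total : ∀ f F → graftCut f (F , []) ≡ sumBy (graftLeaf F) (λ P → f P [])
graftCut-total f F = begin
  pruned + 0ℚ + natℚ 0 * f (leaf ∷ F) []  ≡⟨ cong₂ _+_ (ℚ.+-identityʳ pruned) (ℚ.*-zeroˡ (f (leaf ∷ F) [])) ⟩
  pruned + 0ℚ                             ≡⟨ ℚ.+-identityʳ pruned ⟩
  pruned                                  ∎
  where
  open ≡-Reasoning
  pruned : ℚ
  pruned = sumBy (graftLeaf F) (λ P → f P [])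

graftCut-· : ∀ f → LeafInvariant f → ∀ P₁ R₁ P₂ R₂ →
  graftCut f (P₁ ++ P₂ , R₁ ++ R₂) ≡
  graftCut (λ P R → f (P ++ P₂) (R ++ R₂)) (P₁ , R₁) + graftCut (λ P R → f (P₁ ++ P) (R₁ ++ R)) (P₂ , R₂)
graftCut-· f inv P₁ R₁ P₂ R₂ = begin
  sumBy (graftLeaf (P₁ ++ P₂)) (λ P → f P (R₁ ++ R₂)) + sumBy (graftLeaf (R₁ ++ R₂)) (f (P₁ ++ P₂))
    + natℚ (sizeF (R₁ ++ R₂)) * a
    ≡⟨ cong₂ _+_ (cong₂ _+_ (sumBy-graftLeaf-++ P₁ P₂ _) (sumBy-graftLeaf-++ R₁ R₂ _)) leafCut-split ⟩
  ((x₁ + x₂) + (y₁ + y₂)) + (z₁ + z₂)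
    ≡⟨ cong (_+ (z₁ + z₂)) (ℚ+.interchange x₁ x₂ y₁ y₂) ⟩
  ((x₁ + y₁) + (x₂ + y₂)) + (z₁ + z₂)
    ≡⟨ ℚ+.interchange (x₁ + y₁) (x₂ + y₂) z₁ z₂ ⟩
  ((x₁ + y₁) + z₁) + ((x₂ + y₂) + z₂) ∎
  where
  open ≡-Reasoning
  a x₁ x₂ y₁ y₂ z₁ z₂ : ℚ
  a = f (leaf ∷ P₁ ++ P₂) (R₁ ++ R₂)
  x₁ = sumBy (graftLeaf P₁) (λ P → f (P ++ P₂) (R₁ ++ R₂))
  x₂ = sumBy (graftLeaf P₂) (λ P → f (P₁ ++ P) (R₁ ++ R₂))
  y₁ = sumBy (graftLeaf R₁) (λ R → f (P₁ ++ P₂) (R ++ R₂))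
  y₂ = sumBy (graftLeaf R₂) (λ R → f (P₁ ++ P₂) (R₁ ++ R))
  z₁ = natℚ (sizeF R₁) * a
  z₂ = natℚ (sizeF R₂) * f (P₁ ++ leaf ∷ P₂) (R₁ ++ R₂)
  leafCut-split : natℚ (sizeF (R₁ ++ R₂)) * a ≡ z₁ + z₂
  leafCut-split = begin
    natℚ (sizeF (R₁ ++ R₂)) * a                    ≡⟨ cong (λ n → natℚ n * a) (sizeF-++ R₁ R₂) ⟩
    natℚ (sizeF R₁ ℕ.+ sizeF R₂) * a               ≡⟨ cong (_* a) (natℚ-+ (sizeF R₁) (sizeF R₂)) ⟩
    (natℚ (sizeF R₁) + natℚ (sizeF R₂)) * a        ≡⟨ ℚ.*-distribʳ-+ a (natℚ (sizeF R₁)) (natℚ (sizeF R₂)) ⟩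
    z₁ + natℚ (sizeF R₂) * a                       ≡⟨ cong (λ b → z₁ + natℚ (sizeF R₂) * b) (inv P₁ P₂ (R₁ ++ R₂)) ⟨
    z₁ + z₂                                        ∎

graftCut-node : ∀ f → LeafInvariant f → ∀ P R →
  graftCut f (P , node R ∷ []) ≡
  graftCut (λ P R → f P (node R ∷ [])) (P , R)
    + sumBy (cutsF (leaf ∷ [])) (λ (P₂ , R₂) → f (P ++ P₂) (node (R ++ R₂) ∷ []))
graftCut-node f inv P R = begin
  x + sumBy (graftLeaf (node R ∷ [])) (f P) + natℚ (suc (sizeF R) ℕ.+ 0) * a
    ≡⟨ cong₂ (λ s n → x + s + natℚ n * a)
             (trans (sumBy-graftLeaf-tree (node R) (f P)) (sumBy-graftLeafT-node R (λ t′ → f P (t′ ∷ []))))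
             (ℕ.+-identityʳ (suc (sizeF R))) ⟩
  x + (b + y) + natℚ (suc (sizeF R)) * a
    ≡⟨ cong (x + (b + y) +_) (natℚ-suc-* (sizeF R) a) ⟩
  x + (b + y) + (a + z)
    ≡⟨ rearrange x b y a z ⟩
  x + y + z + (a + (b + 0ℚ))
    ≡⟨ cong (λ a′ → x + y + z + (a′ + (b + 0ℚ))) a-as-cut ⟩
  x + y + z + (f (P ++ leaf ∷ []) (node (R ++ []) ∷ []) + (f P (node (R ++ leaf ∷ []) ∷ []) + 0ℚ))
    ≡⟨ cong (λ P′ → x + y + z + (f (P ++ leaf ∷ []) (node (R ++ []) ∷ []) + (f P′ (node (R ++ leaf ∷ []) ∷ []) + 0ℚ)))
            (List.++-identityʳ P) ⟨
  x + y + z + (f (P ++ leaf ∷ []) (node (R ++ []) ∷ []) + (f (P ++ []) (node (R ++ leaf ∷ []) ∷ []) + 0ℚ)) ∎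
  where
  open ≡-Reasoning
  open +-*-Solver
  a b x y z : ℚ
  a = f (leaf ∷ P) (node R ∷ [])
  b = f P (node (R ++ leaf ∷ []) ∷ [])
  x = sumBy (graftLeaf P) (λ P′ → f P′ (node R ∷ []))
  y = sumBy (graftLeaf R) (λ R′ → f P (node R′ ∷ []))
  z = natℚ (sizeF R) * a
  rearrange : ∀ x b y a z → x + (b + y) + (a + z) ≡ x + y + z + (a + (b + 0ℚ))
  rearrange = solve 5 (λ x b y a z → x :+ (b :+ y) :+ (a :+ z) := x :+ y :+ z :+ (a :+ (b :+ con 0ℚ))) refl
  a-as-cut : a ≡ f (P ++ leaf ∷ []) (node (R ++ []) ∷ [])
  a-as-cut = sym (trans (cong₂ f refl (cong (λ R′ → node R′ ∷ []) (List.++-identityʳ R)))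
                 (trans (inv P [] (node R ∷ [])) (cong (λ P′ → f (leaf ∷ P′) (node R ∷ [])) (List.++-identityʳ P))))

mutual
  sumBy-cutsT-graftLeafT : ∀ t f → LeafInvariant f →
    sumBy (graftLeafT t) (λ t′ → sumBy (cutsT t′) (uncurry f)) ≡ sumBy (cutsT t) (graftCut f)
  sumBy-cutsT-graftLeafT (node ts) f inv = begin
    sumBy (graftLeafT (node ts)) (λ t′ → sumBy (cutsT t′) (uncurry f))
      ≡⟨ sumBy-graftLeafT-node ts (λ t′ → sumBy (cutsT t′) (uncurry f)) ⟩
    sumBy (cutsT (node (ts ++ leaf ∷ []))) (uncurry f) + sumBy (graftLeaf ts) (λ G → sumBy (cutsT (node G)) (uncurry f))
      ≡⟨ cong₂ _+_ (sumBy-cutsT-node (ts ++ leaf ∷ []) (uncurry f))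
                   (trans (sumBy-cong (graftLeaf ts) (λ G → sumBy-cutsT-node G (uncurry f)))
                          (sumBy-+ (graftLeaf ts) (λ G → f (node G ∷ []) []) (λ G → sumBy (cutsF G) (uncurry f′)))) ⟩
    (u + sumBy (cutsF (ts ++ leaf ∷ [])) (uncurry f′)) + (v + sumBy (graftLeaf ts) (λ G → sumBy (cutsF G) (uncurry f′)))
      ≡⟨ cong₂ (λ s s′ → (u + s) + (v + s′)) (sumBy-cutsF-++ ts (leaf ∷ []) _)
                                              (sumBy-cutsF-graftLeaf ts f′ (λ X Y R → inv X Y (node R ∷ []))) ⟩
    (u + sumBy (cutsF ts) newLeaf) + (v + sumBy (cutsF ts) (graftCut f′))
      ≡⟨ ℚ+.interchange u _ v _ ⟩
    (u + v) + (sumBy (cutsF ts) newLeaf + sumBy (cutsF ts) (graftCut f′))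
      ≡⟨ cong₂ _+_ root (trans (ℚ.+-comm (sumBy (cutsF ts) newLeaf) _) (sym (sumBy-+ (cutsF ts) (graftCut f′) newLeaf))) ⟩
    graftCut f (node ts ∷ [] , []) + sumBy (cutsF ts) (λ c → graftCut f′ c + newLeaf c)
      ≡⟨ cong (graftCut f (node ts ∷ [] , []) +_) (sumBy-cong (cutsF ts) (λ (P , R) → graftCut-node f inv P R)) ⟨
    graftCut f (node ts ∷ [] , []) + sumBy (cutsF ts) (λ (P , R) → graftCut f (P , node R ∷ []))
      ≡⟨ sumBy-cutsT-node ts (graftCut f) ⟨
    sumBy (cutsT (node ts)) (graftCut f) ∎
    where
    open ≡-Reasoning
    f′ : Forest → Forest → ℚ
    f′ P R = f P (node R ∷ [])
    newLeaf : Forest × Forest → ℚ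
    newLeaf (P , R) = sumBy (cutsF (leaf ∷ [])) (λ (P₂ , R₂) → f (P ++ P₂) (node (R ++ R₂) ∷ []))
    u v : ℚ
    u = f (node (ts ++ leaf ∷ []) ∷ []) []
    v = sumBy (graftLeaf ts) (λ G → f (node G ∷ []) [])
    root : u + v ≡ graftCut f (node ts ∷ [] , [])
    root = sym (begin
      graftCut f (node ts ∷ [] , [])
        ≡⟨ graftCut-total f (node ts ∷ []) ⟩
      sumBy (graftLeaf (node ts ∷ [])) (λ P → f P [])
        ≡⟨ sumBy-graftLeaf-tree (node ts) (λ P → f P []) ⟩
      sumBy (graftLeafT (node ts)) (λ t′ → f (t′ ∷ []) [])
        ≡⟨ sumBy-graftLeafT-node ts (λ t′ → f (t′ ∷ []) []) ⟩
      u + v ∎)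

  sumBy-cutsF-graftLeaf : ∀ F f → LeafInvariant f →
    sumBy (graftLeaf F) (λ G → sumBy (cutsF G) (uncurry f)) ≡ sumBy (cutsF F) (graftCut f)
  sumBy-cutsF-graftLeaf []       f inv = sym (trans (ℚ.+-identityʳ _) (graftCut-total f []))
  sumBy-cutsF-graftLeaf (t ∷ ts) f inv = begin
    sumBy (graftLeaf (t ∷ ts)) H
      ≡⟨ sumBy-graftLeaf-∷ t ts H ⟩
    sumBy (graftLeafT t) (λ t′ → H (t′ ∷ ts)) + sumBy (graftLeaf ts) (λ G → H (t ∷ G))
      ≡⟨ cong₂ _+_ grafted-into-t grafted-into-ts ⟩
    sumBy (cutsT t) (λ c₁ → sumBy (cutsF ts) (λ c₂ → graftCut (after c₂) c₁))
      + sumBy (cutsT t) (λ c₁ → sumBy (cutsF ts) (graftCut (before c₁)))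
      ≡⟨ sumBy-+ (cutsT t) _ _ ⟨
    sumBy (cutsT t) (λ c₁ → sumBy (cutsF ts) (λ c₂ → graftCut (after c₂) c₁)
                           + sumBy (cutsF ts) (graftCut (before c₁)))
      ≡⟨ sumBy-cong (cutsT t) (λ c₁ → sym (sumBy-+ (cutsF ts) _ _)) ⟩
    sumBy (cutsT t) (λ c₁ → sumBy (cutsF ts) (λ c₂ → graftCut (after c₂) c₁ + graftCut (before c₁) c₂))
      ≡⟨ sumBy-cong (cutsT t) (λ (P₁ , R₁) → sumBy-cong (cutsF ts) (λ (P₂ , R₂) → graftCut-· f inv P₁ R₁ P₂ R₂)) ⟨
    sumBy (cutsT t) (λ c₁ → sumBy (cutsF ts) (λ c₂ → graftCut f (c₁ · c₂)))
      ≡⟨ sumBy-cutsF-∷ t ts (graftCut f) ⟨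
    sumBy (cutsF (t ∷ ts)) (graftCut f) ∎
    where
    open ≡-Reasoning
    H : Forest → ℚ
    H G = sumBy (cutsF G) (uncurry f)
    after before : Forest × Forest → Forest → Forest → ℚ
    after (P₂ , R₂) P R = f (P ++ P₂) (R ++ R₂)
    before (P₁ , R₁) P R = f (P₁ ++ P) (R₁ ++ R)
    grafted-into-t : sumBy (graftLeafT t) (λ t′ → H (t′ ∷ ts))
                     ≡ sumBy (cutsT t) (λ c₁ → sumBy (cutsF ts) (λ c₂ → graftCut (after c₂) c₁))
    grafted-into-t = begin
      sumBy (graftLeafT t) (λ t′ → H (t′ ∷ ts))
        ≡⟨ sumBy-cong (graftLeafT t) (λ t′ → sumBy-cutsF-∷ t′ ts (uncurry f)) ⟩
      sumBy (graftLeafT t) (λ t′ → sumBy (cutsT t′) (uncurry (λ P R → sumBy (cutsF ts) (λ c₂ → after c₂ P R))))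
        ≡⟨ sumBy-cutsT-graftLeafT t _
             (LeafInvariant-sumBy (cutsF ts) after (λ (P₂ , R₂) → LeafInvariant-suffix f P₂ R₂ inv)) ⟩
      sumBy (cutsT t) (graftCut (λ P R → sumBy (cutsF ts) (λ c₂ → after c₂ P R)))
        ≡⟨ sumBy-cong (cutsT t) (graftCut-sumBy (cutsF ts) after) ⟩
      sumBy (cutsT t) (λ c₁ → sumBy (cutsF ts) (λ c₂ → graftCut (after c₂) c₁)) ∎
    grafted-into-ts : sumBy (graftLeaf ts) (λ G → H (t ∷ G))
                      ≡ sumBy (cutsT t) (λ c₁ → sumBy (cutsF ts) (graftCut (before c₁)))
    grafted-into-ts = begin
      sumBy (graftLeaf ts) (λ G → H (t ∷ G))
        ≡⟨ sumBy-cong (graftLeaf ts) (λ G → sumBy-cutsF-∷ t G (uncurry f)) ⟩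
      sumBy (graftLeaf ts) (λ G → sumBy (cutsT t) (λ c₁ → sumBy (cutsF G) (uncurry (before c₁))))
        ≡⟨ sumBy-swap (graftLeaf ts) (cutsT t) _ ⟩
      sumBy (cutsT t) (λ c₁ → sumBy (graftLeaf ts) (λ G → sumBy (cutsF G) (uncurry (before c₁))))
        ≡⟨ sumBy-cong (cutsT t) (λ (P₁ , R₁) → sumBy-cutsF-graftLeaf ts _ (LeafInvariant-prefix f P₁ R₁ inv)) ⟩
      sumBy (cutsT t) (λ c₁ → sumBy (cutsF ts) (graftCut (before c₁))) ∎

mutual
  graftLeafT-size : ∀ t → ListAll (λ t′ → sizeT t′ ≡ suc (sizeT t)) (graftLeafT t)
  graftLeafT-size (node us) = cong suc (trans (sizeF-++ us (leaf ∷ [])) (ℕ.+-comm (sizeF us) 1))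
                            ∷ ListAll.map⁺ (ListAll.map (cong suc) (graftLeaf-size us))

  graftLeaf-size : ∀ F → ListAll (λ H → sizeF H ≡ suc (sizeF F)) (graftLeaf F)
  graftLeaf-size []       = []
  graftLeaf-size (t ∷ ts) = ListAll.++⁺ (ListAll.map⁺ (ListAll.map (cong (ℕ._+ sizeF ts)) (graftLeafT-size t)))
    (ListAll.map⁺ (ListAll.map (λ e → trans (cong (sizeT t ℕ.+_) e) (ℕ.+-suc (sizeT t) (sizeF ts))) (graftLeaf-size ts)))

sumBy-graftL-leaf : ∀ x (ψ : Forest → ℚ) →
  sumBy (graftL x (forestL (leaf ∷ []))) (λ (c , H) → c * ψ H) ≡ sumBy x (λ (c , F) → c * sumBy (graftLeaf F) ψ)
sumBy-graftL-leaf x ψ = trans (sumBy-concatMap _ x _) (sumBy-cong x (λ (c , F) → begin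
  sumBy (map (λ H → (c * 1ℚ , H)) (graftLeaf F) ++ []) (λ (d , H) → d * ψ H)
    ≡⟨ trans (sumBy-++ (map (λ H → (c * 1ℚ , H)) (graftLeaf F)) [] _) (ℚ.+-identityʳ _) ⟩
  sumBy (map (λ H → (c * 1ℚ , H)) (graftLeaf F)) (λ (d , H) → d * ψ H)
    ≡⟨ trans (sumBy-map _ (graftLeaf F) _) (sumBy-*ˡ (c * 1ℚ) (graftLeaf F) ψ) ⟩
  c * 1ℚ * sumBy (graftLeaf F) ψ
    ≡⟨ cong (_* sumBy (graftLeaf F) ψ) (ℚ.*-identityʳ c) ⟩
  c * sumBy (graftLeaf F) ψ ∎))
  where open ≡-Reasoning

δ-size : ∀ k → ListAll (λ (c , F) → sizeF F ≡ suc k) (δ k)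
δ-size zero    = refl ∷ []
δ-size (suc k) = All-concatMap⁺ _ (ListAll.map (λ { {c , F} e →
  ListAll.++⁺ (ListAll.map⁺ (ListAll.map (λ eH → trans eH (cong suc e)) (graftLeaf-size F))) [] }) (δ-size k))

sumCodes : (List Bool → ℚ) → LinComb → ℚ
sumCodes h x = sumBy x (λ (c , F) → c * h (codeF F))

dropCode : List Bool → LinComb → LinComb
dropCode w []            = []
dropCode w ((c , F) ∷ x) = if does (≡-dec _≟ᵇ_ (codeF F) w) then dropCode w x else (c , F) ∷ dropCode w x

sumCodes-split : ∀ h w x → sumCodes h x ≡ h w * coeff w x + sumCodes h (dropCode w x)
sumCodes-split h w []            = sym (trans (cong (_+ 0ℚ) (ℚ.*-zeroʳ (h w))) (ℚ.+-identityʳ 0ℚ))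
sumCodes-split h w ((c , F) ∷ x) with ≡-dec _≟ᵇ_ (codeF F) w
... | yes refl = trans (cong (c * h w +_) (sumCodes-split h w x))
  (solve 4 (λ c a k s → c :* a :+ (a :* k :+ s) := a :* (c :+ k) :+ s) refl c (h w) (coeff w x) (sumCodes h (dropCode w x)))
  where open +-*-Solver
... | no _     = trans (cong (c * h (codeF F) +_) (sumCodes-split h w x))
  (ℚ+.x∙yz≈y∙xz (c * h (codeF F)) (h w * coeff w x) (sumCodes h (dropCode w x)))

coeff-∷-≡ : ∀ w c F x → codeF F ≡ w → coeff w ((c , F) ∷ x) ≡ c + coeff w x
coeff-∷-≡ w c F x e with ≡-dec _≟ᵇ_ (codeF F) w
... | yes _ = refl
... | no ne = ⊥-elim (ne e)

coeff-∷-≢ : ∀ w c F x → codeF F ≢ w → coeff w ((c , F) ∷ x) ≡ coeff w x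
coeff-∷-≢ w c F x ne with ≡-dec _≟ᵇ_ (codeF F) w
... | yes e = ⊥-elim (ne e)
... | no  _ = refl

coeff-dropCode : ∀ v w x → coeff v (dropCode w x) ≡ (if does (≡-dec _≟ᵇ_ v w) then 0ℚ else coeff v x)
coeff-dropCode v w [] with ≡-dec _≟ᵇ_ v w
... | yes _ = refl
... | no  _ = refl
coeff-dropCode v w ((c , F) ∷ x)
  with ≡-dec _≟ᵇ_ (codeF F) w | ≡-dec _≟ᵇ_ (codeF F) v | ≡-dec _≟ᵇ_ v w | coeff-dropCode v w x
... | yes _  | _      | yes _   | IH = IH
... | yes Fw | yes Fv | no  v≢w | IH = ⊥-elim (v≢w (trans (sym Fv) Fw))
... | yes _  | no  _  | no  _   | IH = IH
... | no  F≢w | _     | yes v≡w | IH = trans (coeff-∷-≢ v c F (dropCode w x) (λ Fv → F≢w (trans Fv v≡w))) IH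
... | no  _  | yes Fv | no  _   | IH = trans (coeff-∷-≡ v c F (dropCode w x) Fv) (cong (c +_) IH)
... | no  _  | no  F≢v | no  _  | IH = trans (coeff-∷-≢ v c F (dropCode w x) F≢v) IH

dropCode-resp-≈ : ∀ w x y → x ≈ y → dropCode w x ≈ dropCode w y
dropCode-resp-≈ w x y x≈y v with ≡-dec _≟ᵇ_ v w | coeff-dropCode v w x | coeff-dropCode v w y
... | yes _ | ex | ey = trans ex (sym ey)
... | no  _ | ex | ey = trans ex (trans (x≈y v) (sym ey))

length-dropCode : ∀ w x → length (dropCode w x) ≤ length x
length-dropCode w []            = z≤n
length-dropCode w ((c , F) ∷ x) with does (≡-dec _≟ᵇ_ (codeF F) w)
... | true  = ℕ.m≤n⇒m≤1+n (length-dropCode w x)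
... | false = s≤s (length-dropCode w x)

length-dropCode-< : ∀ c F x → length (dropCode (codeF F) ((c , F) ∷ x)) < length ((c , F) ∷ x)
length-dropCode-< c F x with ≡-dec _≟ᵇ_ (codeF F) (codeF F)
... | yes _ = s≤s (length-dropCode (codeF F) x)
... | no  F≢F = ⊥-elim (F≢F refl)

sumCodes-resp-≈-by : ∀ h w {k} → (∀ x y → length x ℕ.+ length y ≤ k → x ≈ y → sumCodes h x ≡ sumCodes h y) →
  ∀ x y → length (dropCode w x) ℕ.+ length (dropCode w y) ≤ k → x ≈ y → sumCodes h x ≡ sumCodes h y
sumCodes-resp-≈-by h w IH x y ≤k x≈y = begin
  sumCodes h x                                         ≡⟨ sumCodes-split h w x ⟩
  h w * coeff w x + sumCodes h (dropCode w x)          ≡⟨ cong₂ _+_ (cong (h w *_) (x≈y w))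
                                                            (IH (dropCode w x) (dropCode w y) ≤k (dropCode-resp-≈ w x y x≈y)) ⟩
  h w * coeff w y + sumCodes h (dropCode w y)          ≡⟨ sumCodes-split h w y ⟨
  sumCodes h y                                         ∎
  where open ≡-Reasoning

sumCodes-resp-≈-≤ : ∀ k h x y → length x ℕ.+ length y ≤ k → x ≈ y → sumCodes h x ≡ sumCodes h y
sumCodes-resp-≈-≤ _       h []            []            _  _   = refl
sumCodes-resp-≈-≤ zero    h ((_ , _) ∷ _) _             () _
sumCodes-resp-≈-≤ zero    h []            ((_ , _) ∷ _) () _
sumCodes-resp-≈-≤ (suc k) h x@((c , F) ∷ x′) y xy≤ = sumCodes-resp-≈-by h (codeF F) (sumCodes-resp-≈-≤ k h) x y
  (ℕ.≤-pred (ℕ.≤-trans (ℕ.+-mono-≤ (length-dropCode-< c F x′) (length-dropCode (codeF F) y)) xy≤))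
sumCodes-resp-≈-≤ (suc k) h [] y@((d , G) ∷ y′) xy≤ = sumCodes-resp-≈-by h (codeF G) (sumCodes-resp-≈-≤ k h) [] y
  (ℕ.≤-pred (ℕ.≤-trans (length-dropCode-< d G y′) xy≤))

sumCodes-resp-≈ : ∀ h x y → x ≈ y → sumCodes h x ≡ sumCodes h y
sumCodes-resp-≈ h x y = sumCodes-resp-≈-≤ _ h x y ℕ.≤-refl

insertCode-↭ : ∀ t ts → Σ[ ts′ ∈ Forest ] insertCode (codeT t) (codesF ts) ≡ codesF ts′ × ts′ ↭ t ∷ ts
insertCode-↭ t []       = t ∷ [] , refl , ↭-refl
insertCode-↭ t (s ∷ ss) with leqCode (codeT t) (codeT s)
... | true  = t ∷ s ∷ ss , refl , ↭-refl
... | false with insertCode-↭ t ss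
...   | ss′ , e , p = s ∷ ss′ , cong (codeT s ∷_) e , ↭-trans (↭-prep s p) (↭-swap s t ↭-refl)

sortCodes-↭ : ∀ ts → Σ[ ts′ ∈ Forest ] sortCodes (codesF ts) ≡ codesF ts′ × ts′ ↭ ts
sortCodes-↭ []       = [] , refl , ↭-refl
sortCodes-↭ (t ∷ ts) with sortCodes-↭ ts
... | ts′ , e , p with insertCode-↭ t ts′
...   | ts″ , e′ , p′ = ts″ , trans (cong (insertCode (codeT t)) e) e′ , ↭-trans p′ (↭-prep t p)

codeF-∷ : ∀ u us → Σ[ w ∈ List Bool ] codeF (u ∷ us) ≡ true ∷ w
codeF-∷ u us with sortCodes-↭ (u ∷ us)
... | [] , _ , p with ↭-length p
...   | ()
codeF-∷ u us | node _ ∷ _ , e , _ = _ , cong concat e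

infixl 6 _+ᵛ_ _⊕_

_+ᵛ_ : ∀ {m} → Vec ℕ m → Vec ℕ m → Vec ℕ m
_+ᵛ_ = zipWith ℕ._+_

0ᵛ : ∀ {m} → Vec ℕ m
0ᵛ = replicate _ 0

+ᵛ-assoc : ∀ {m} (u v w : Vec ℕ m) → (u +ᵛ v) +ᵛ w ≡ u +ᵛ (v +ᵛ w)
+ᵛ-assoc u v w = Pointwise-≡⇒≡ (zipWith-assoc ℕ.+-assoc u v w)

+ᵛ-comm : ∀ {m} (u v : Vec ℕ m) → u +ᵛ v ≡ v +ᵛ u
+ᵛ-comm u v = Pointwise-≡⇒≡ (zipWith-comm ℕ.+-comm u v)

+ᵛ-identityˡ : ∀ {m} (u : Vec ℕ m) → 0ᵛ +ᵛ u ≡ u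
+ᵛ-identityˡ u = Pointwise-≡⇒≡ (zipWith-identityˡ ℕ.+-identityˡ u)

+ᵛ-identityʳ : ∀ {m} (u : Vec ℕ m) → u +ᵛ 0ᵛ ≡ u
+ᵛ-identityʳ u = Pointwise-≡⇒≡ (zipWith-identityʳ ℕ.+-identityʳ u)

+ᵛ-interchange : ∀ {m} (u v w x : Vec ℕ m) → (u +ᵛ v) +ᵛ (w +ᵛ x) ≡ (u +ᵛ w) +ᵛ (v +ᵛ x)
+ᵛ-interchange u v w x = Pointwise-≡⇒≡ (zipWith-interchange u v w x)
  where
  zipWith-interchange : ∀ {m} (u v w x : Vec ℕ m) → Pointwise _≡_ ((u +ᵛ v) +ᵛ (w +ᵛ x)) ((u +ᵛ w) +ᵛ (v +ᵛ x))
  zipWith-interchange []       []       []       []       = []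
  zipWith-interchange (a ∷ u) (b ∷ v) (c ∷ w) (d ∷ x) = ℕ+.interchange a b c d ∷ zipWith-interchange u v w x

-- nothing stands for a forest killed by the projection: it absorbs ⊕ and ev sends it to 0.
_⊕_ : ∀ {m} → Maybe (Vec ℕ m) → Maybe (Vec ℕ m) → Maybe (Vec ℕ m)
just u  ⊕ just v  = just (u +ᵛ v)
just _  ⊕ nothing = nothing
nothing ⊕ _       = nothing

⊕-assoc : ∀ {m} (a b c : Maybe (Vec ℕ m)) → (a ⊕ b) ⊕ c ≡ a ⊕ (b ⊕ c)
⊕-assoc (just u) (just v) (just w) = cong just (+ᵛ-assoc u v w)
⊕-assoc (just _) (just _) nothing  = refl
⊕-assoc (just _) nothing  _        = refl
⊕-assoc nothing  _        _        = refl

⊕-comm : ∀ {m} (a b : Maybe (Vec ℕ m)) → a ⊕ b ≡ b ⊕ a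
⊕-comm (just u) (just v) = cong just (+ᵛ-comm u v)
⊕-comm (just _) nothing  = refl
⊕-comm nothing  (just _) = refl
⊕-comm nothing  nothing  = refl

⊕-identityˡ : ∀ {m} (a : Maybe (Vec ℕ m)) → just 0ᵛ ⊕ a ≡ a
⊕-identityˡ (just u) = cong just (+ᵛ-identityˡ u)
⊕-identityˡ nothing  = refl

ev : ∀ {m} → (Vec ℕ m → ℚ) → Maybe (Vec ℕ m) → ℚ
ev g nothing  = 0ℚ
ev g (just u) = g u

module _ {m : ℕ} where

  ev-cong : ∀ {g h : Vec ℕ m → ℚ} a → (∀ u → g u ≡ h u) → ev g a ≡ ev h a
  ev-cong nothing  g≗h = refl
  ev-cong (just u) g≗h = g≗h u

  ev-zero : ∀ a → ev {m} (λ _ → 0ℚ) a ≡ 0ℚ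
  ev-zero nothing  = refl
  ev-zero (just _) = refl

  ev-*ˡ : ∀ c (g : Vec ℕ m → ℚ) a → ev (λ u → c * g u) a ≡ c * ev g a
  ev-*ˡ c g nothing  = sym (ℚ.*-zeroʳ c)
  ev-*ˡ c g (just _) = refl

  ev-+ : ∀ (g h : Vec ℕ m → ℚ) a → ev (λ u → g u + h u) a ≡ ev g a + ev h a
  ev-+ g h nothing  = sym (ℚ.+-identityʳ 0ℚ)
  ev-+ g h (just _) = refl

  ev-sumBy : ∀ (xs : List A) (f : A → Vec ℕ m → ℚ) a →
             ev (λ u → sumBy xs (λ x → f x u)) a ≡ sumBy xs (λ x → ev (f x) a)
  ev-sumBy xs f nothing  = sym (sumBy-zero xs (λ _ → refl))
  ev-sumBy xs f (just _) = refl

  ev-swap : ∀ (G : Vec ℕ m → Vec ℕ m → ℚ) a b → ev (λ u → ev (G u) b) a ≡ ev (λ v → ev (λ u → G u v) a) b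
  ev-swap G nothing  nothing  = refl
  ev-swap G nothing  (just _) = refl
  ev-swap G (just _) nothing  = refl
  ev-swap G (just _) (just _) = refl

  ev-⊕ : ∀ (g : Vec ℕ m → ℚ) a b → ev g (a ⊕ b) ≡ ev (λ u → ev (λ v → g (u +ᵛ v)) b) a
  ev-⊕ g (just _) (just _) = refl
  ev-⊕ g (just _) nothing  = refl
  ev-⊕ g nothing  _        = refl

-- The k-th unit vector of length m; nothing when k ≥ m, as c_k is then not observed.
unitVec : ∀ m → ℕ → Maybe (Vec ℕ m)
unitVec zero    _       = nothing
unitVec (suc m) zero    = just (1 ∷ 0ᵛ)
unitVec (suc m) (suc k) = Maybe.map (0 ∷_) (unitVec m k)

-- graftDual is the transpose of the derivation c_k ↦ c_{k+1} on monomials in c_0, c_1, …: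
-- (graftDual g) u = Σ_k u_k g (u - e_k + e_{k+1}), the term of the last coordinate dropped.
-- The factor u_k makes the junk value pred 0 = 0 harmless.
graftDual : ∀ {m} → (Vec ℕ m → ℚ) → Vec ℕ m → ℚ
graftDual g []          = 0ℚ
graftDual g (x ∷ [])    = 0ℚ
graftDual g (x ∷ y ∷ r) = natℚ x * g (pred x ∷ suc y ∷ r) + graftDual (g ∘ (x ∷_)) (y ∷ r)

graftDual-zero : ∀ {m} (u : Vec ℕ m) → graftDual (λ _ → 0ℚ) u ≡ 0ℚ
graftDual-zero []          = refl
graftDual-zero (x ∷ [])    = refl
graftDual-zero (x ∷ y ∷ r) = trans (cong₂ _+_ (ℚ.*-zeroʳ (natℚ x)) (graftDual-zero (y ∷ r))) (ℚ.+-identityˡ 0ℚ)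

graftDual-0∷ : ∀ {m} (g : Vec ℕ (suc (suc m)) → ℚ) y r → graftDual g (0 ∷ y ∷ r) ≡ graftDual (g ∘ (0 ∷_)) (y ∷ r)
graftDual-0∷ g y r = trans (cong (_+ graftDual (g ∘ (0 ∷_)) (y ∷ r)) (ℚ.*-zeroˡ (g (0 ∷ suc y ∷ r)))) (ℚ.+-identityˡ _)

graftDual-0ᵛ : ∀ {m} (g : Vec ℕ m → ℚ) → graftDual g 0ᵛ ≡ 0ℚ
graftDual-0ᵛ {zero}        g = refl
graftDual-0ᵛ {suc zero}    g = refl
graftDual-0ᵛ {suc (suc m)} g = trans (graftDual-0∷ g 0 0ᵛ) (graftDual-0ᵛ {suc m} (g ∘ (0 ∷_)))

graftDual-ev : ∀ {m} (G : Vec ℕ m → Vec ℕ m → ℚ) a u →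
               graftDual (λ v → ev (G v) a) u ≡ ev (λ w → graftDual (λ v → G v w) u) a
graftDual-ev G nothing  u = graftDual-zero u
graftDual-ev G (just _) u = refl

graftDual-+ᵛ : ∀ {m} (g : Vec ℕ m → ℚ) u v →
               graftDual g (u +ᵛ v) ≡ graftDual (λ u′ → g (u′ +ᵛ v)) u + graftDual (λ v′ → g (u +ᵛ v′)) v
graftDual-+ᵛ g []          []            = sym (ℚ.+-identityˡ 0ℚ)
graftDual-+ᵛ g (x ∷ [])    (x′ ∷ [])     = sym (ℚ.+-identityˡ 0ℚ)
graftDual-+ᵛ g (x ∷ y ∷ r) (x′ ∷ y′ ∷ r′) = begin
  natℚ (x ℕ.+ x′) * g₀ + graftDual (g ∘ (x ℕ.+ x′ ∷_)) ((y ∷ r) +ᵛ (y′ ∷ r′))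
    ≡⟨ cong₂ _+_ (trans (cong (_* g₀) (natℚ-+ x x′))
                   (trans (ℚ.*-distribʳ-+ g₀ (natℚ x) (natℚ x′))
                          (cong₂ _+_ (natℚ-*-cong-suc x from-u) (natℚ-*-cong-suc x′ from-v))))
                 (graftDual-+ᵛ (g ∘ (x ℕ.+ x′ ∷_)) (y ∷ r) (y′ ∷ r′)) ⟩
  (natℚ x * g₁ + natℚ x′ * g₂) + (b₁ + b₂)
    ≡⟨ ℚ+.interchange (natℚ x * g₁) (natℚ x′ * g₂) b₁ b₂ ⟩
  (natℚ x * g₁ + b₁) + (natℚ x′ * g₂ + b₂) ∎
  where
  open ≡-Reasoning
  g₀ g₁ g₂ b₁ b₂ : ℚ
  g₀ = g (pred (x ℕ.+ x′) ∷ suc (y ℕ.+ y′) ∷ (r +ᵛ r′))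
  g₁ = g ((pred x ∷ suc y ∷ r) +ᵛ (x′ ∷ y′ ∷ r′))
  g₂ = g ((x ∷ y ∷ r) +ᵛ (pred x′ ∷ suc y′ ∷ r′))
  b₁ = graftDual (λ w → g ((x ∷ w) +ᵛ (x′ ∷ y′ ∷ r′))) (y ∷ r)
  b₂ = graftDual (λ w → g ((x ∷ y ∷ r) +ᵛ (x′ ∷ w))) (y′ ∷ r′)
  from-u : ∀ k → x ≡ suc k → g₀ ≡ g₁
  from-u k refl = refl
  from-v : ∀ k → x′ ≡ suc k → g₀ ≡ g₂
  from-v k refl = cong g (cong₂ (λ a b → a ∷ b ∷ (r +ᵛ r′)) (cong pred (ℕ.+-suc x k)) (sym (ℕ.+-suc y y′)))

graftDual-unitVec : ∀ m k (h : Vec ℕ m → ℚ) → ev h (unitVec m (suc k)) ≡ ev (graftDual h) (unitVec m k)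
graftDual-unitVec zero          k       h = refl
graftDual-unitVec (suc zero)    zero    h = refl
graftDual-unitVec (suc zero)    (suc k) h = refl
graftDual-unitVec (suc (suc m)) zero    h =
  sym (trans (cong₂ _+_ (ℚ.*-identityˡ (h (0 ∷ 1 ∷ 0ᵛ))) (graftDual-0ᵛ {suc m} (h ∘ (1 ∷_)))) (ℚ.+-identityʳ _))
graftDual-unitVec (suc (suc m)) (suc k) h = begin
  ev h (Maybe.map (0 ∷_) (unitVec (suc m) (suc k)))  ≡⟨ ev-map₀ h (unitVec (suc m) (suc k)) ⟩
  ev (h ∘ (0 ∷_)) (unitVec (suc m) (suc k))          ≡⟨ graftDual-unitVec (suc m) k (h ∘ (0 ∷_)) ⟩
  ev (graftDual (h ∘ (0 ∷_))) (unitVec (suc m) k)    ≡⟨ ev-cong (unitVec (suc m) k) (λ { (y ∷ r) → sym (graftDual-0∷ h y r) }) ⟩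
  ev (graftDual h ∘ (0 ∷_)) (unitVec (suc m) k)      ≡⟨ ev-map₀ (graftDual h) (unitVec (suc m) k) ⟨
  ev (graftDual h) (Maybe.map (0 ∷_) (unitVec (suc m) k)) ∎
  where
  open ≡-Reasoning
  ev-map₀ : ∀ {j} (f : Vec ℕ (suc j) → ℚ) a → ev f (Maybe.map (0 ∷_) a) ≡ ev (f ∘ (0 ∷_)) a
  ev-map₀ f nothing  = refl
  ev-map₀ f (just _) = refl

pow⊕ : ∀ {m} → ℕ → Maybe (Vec ℕ m) → Maybe (Vec ℕ m)
pow⊕ zero    a = just 0ᵛ
pow⊕ (suc k) a = a ⊕ pow⊕ k a

-- monoExp k i is the exponent vector of c_k^{i_1} c_{k+1}^{i_2} ⋯,
-- the projection of δ_{k+1}^{i_1} δ_{k+2}^{i_2} ⋯.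
monoExp : ∀ {m l} → ℕ → Vec ℕ l → Maybe (Vec ℕ m)
monoExp k []       = just 0ᵛ
monoExp k (x ∷ xs) = pow⊕ x (unitVec _ k) ⊕ monoExp (suc k) xs

private
  map-0∷ : ∀ {m} → Maybe (Vec ℕ m) → Maybe (Vec ℕ (suc m))
  map-0∷ = Maybe.map (0 ∷_)

  ⊕-map-0∷ : ∀ {m} (a b : Maybe (Vec ℕ m)) → map-0∷ a ⊕ map-0∷ b ≡ map-0∷ (a ⊕ b)
  ⊕-map-0∷ (just _) (just _) = refl
  ⊕-map-0∷ (just _) nothing  = refl
  ⊕-map-0∷ nothing  _        = refl

  pow⊕-map-0∷ : ∀ {m} k (a : Maybe (Vec ℕ m)) → pow⊕ k (map-0∷ a) ≡ map-0∷ (pow⊕ k a)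
  pow⊕-map-0∷ zero    a = refl
  pow⊕-map-0∷ (suc k) a = trans (cong (map-0∷ a ⊕_) (pow⊕-map-0∷ k a)) (⊕-map-0∷ a (pow⊕ k a))

  pow⊕-e₀ : ∀ {m} k → pow⊕ {suc m} k (just (1 ∷ 0ᵛ)) ≡ just (k ∷ 0ᵛ)
  pow⊕-e₀ zero    = refl
  pow⊕-e₀ (suc k) = trans (cong (just (1 ∷ 0ᵛ) ⊕_) (pow⊕-e₀ k)) (cong (λ v → just (suc k ∷ v)) (+ᵛ-identityˡ 0ᵛ))

  monoExp-suc : ∀ {m l} k (xs : Vec ℕ l) → monoExp {suc m} (suc k) xs ≡ map-0∷ (monoExp {m} k xs)
  monoExp-suc k []       = refl
  monoExp-suc {m} k (x ∷ xs) = trans (cong₂ _⊕_ (pow⊕-map-0∷ x (unitVec m k)) (monoExp-suc (suc k) xs))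
                                     (⊕-map-0∷ (pow⊕ x (unitVec m k)) (monoExp (suc k) xs))

  monoExp-∷ : ∀ {m l} x (xs : Vec ℕ l) {w} → monoExp {m} 0 xs ≡ just w → monoExp {suc m} 0 (x ∷ xs) ≡ just (x ∷ w)
  monoExp-∷ x xs {w} e = trans (cong₂ _⊕_ (pow⊕-e₀ x) (trans (monoExp-suc 0 xs) (cong map-0∷ e)))
                               (cong₂ (λ a v → just (a ∷ v)) (ℕ.+-identityʳ x) (+ᵛ-identityˡ w))

monoExp-id : ∀ {m} (i : Vec ℕ m) → monoExp 0 i ≡ just i
monoExp-id []       = refl
monoExp-id (x ∷ xs) = monoExp-∷ x xs (monoExp-id xs)

monoExp-∷ʳ0 : ∀ {m} (i : Vec ℕ m) → monoExp 0 i ≡ just (i ∷ʳ 0)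
monoExp-∷ʳ0 []       = refl
monoExp-∷ʳ0 (x ∷ xs) = monoExp-∷ x xs (monoExp-∷ʳ0 xs)

leafCount : Forest → Maybe ℕ
leafCount []                  = just 0
leafCount (node []      ∷ ts) = Maybe.map suc (leafCount ts)
leafCount (node (_ ∷ _) ∷ _)  = nothing

leafCount-∷ʳ : ∀ ts → leafCount (ts ++ leaf ∷ []) ≡ Maybe.map suc (leafCount ts)
leafCount-∷ʳ []                  = refl
leafCount-∷ʳ (node []      ∷ ts) = cong (Maybe.map suc) (leafCount-∷ʳ ts)
leafCount-∷ʳ (node (_ ∷ _) ∷ ts) = refl

graftLeaf-nonEmpty : ∀ F → ListAll NonEmpty (graftLeaf F)
graftLeaf-nonEmpty []       = []
graftLeaf-nonEmpty (t ∷ ts) =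
  ListAll.++⁺ (ListAll.map⁺ (ListAll.universal (λ _ → nonEmpty) (graftLeafT t)))
              (ListAll.map⁺ (ListAll.universal (λ _ → nonEmpty) (graftLeaf ts)))

NotLeaf : Tree → Set
NotLeaf (node ts) = NonEmpty ts

graftLeafT-notLeaf : ∀ t → ListAll NotLeaf (graftLeafT t)
graftLeafT-notLeaf (node us) = ++-nonEmpty us ∷ ListAll.map⁺ (graftLeaf-nonEmpty us)
  where
  ++-nonEmpty : ∀ xs → NonEmpty (xs ++ leaf ∷ [])
  ++-nonEmpty []      = nonEmpty
  ++-nonEmpty (_ ∷ _) = nonEmpty

graftLeaf-leafCount : ∀ F → ListAll (λ G → leafCount G ≡ nothing) (graftLeaf F)
graftLeaf-leafCount []       = []
graftLeaf-leafCount (t ∷ ts) =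
  ListAll.++⁺ (ListAll.map⁺ (ListAll.map notLeaf (graftLeafT-notLeaf t)))
              (ListAll.map⁺ (ListAll.map (∷-nothing t) (graftLeaf-leafCount ts)))
  where
  notLeaf : ∀ {t′} → NotLeaf t′ → leafCount (t′ ∷ ts) ≡ nothing
  notLeaf {node (_ ∷ _)} nonEmpty = refl
  ∷-nothing : ∀ t {G} → leafCount G ≡ nothing → leafCount (t ∷ G) ≡ nothing
  ∷-nothing (node [])      e = cong (Maybe.map suc) e
  ∷-nothing (node (_ ∷ _)) e = refl

leafCount-↭ : ∀ {F G} → F ↭ G → leafCount F ≡ leafCount G
leafCount-↭ Perm.refl = refl
leafCount-↭ (Perm.prep (node [])      p) = cong (Maybe.map suc) (leafCount-↭ p)
leafCount-↭ (Perm.prep (node (_ ∷ _)) p) = refl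
leafCount-↭ (Perm.swap (node [])      (node [])      p) = cong (Maybe.map suc ∘ Maybe.map suc) (leafCount-↭ p)
leafCount-↭ (Perm.swap (node [])      (node (_ ∷ _)) p) = refl
leafCount-↭ (Perm.swap (node (_ ∷ _)) (node [])      p) = refl
leafCount-↭ (Perm.swap (node (_ ∷ _)) (node (_ ∷ _)) p) = refl
leafCount-↭ (Perm.trans p q) = trans (leafCount-↭ p) (leafCount-↭ q)

-- A forest is seen as the exponent vector of its projection, a monomial in the corollas
-- c_0, …, c_n, or as nothing when the projection kills it.  A function g of exponent
-- vectors then defines the linear functional ⟨_, g⟩ on H_CK.
module Corollas (n : ℕ) where

  Exponent : Set
  Exponent = Vec ℕ (suc n)

  corollaT : Tree → Maybe Exponent
  corollaT (node ts) = leafCount ts >>= unitVec (suc n)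

  corollaF : Forest → Maybe Exponent
  corollaF []       = just 0ᵛ
  corollaF (t ∷ ts) = corollaT t ⊕ corollaF ts

  corollaF-++ : ∀ F G → corollaF (F ++ G) ≡ corollaF F ⊕ corollaF G
  corollaF-++ []      G = sym (⊕-identityˡ (corollaF G))
  corollaF-++ (t ∷ F) G =
    trans (cong (corollaT t ⊕_) (corollaF-++ F G)) (sym (⊕-assoc (corollaT t) (corollaF F) (corollaF G)))

  ⟨_,_⟩ : LinComb → (Exponent → ℚ) → ℚ
  ⟨ x , g ⟩ = sumBy x (λ (c , F) → c * ev g (corollaF F))

  ⟨⟩-cong : ∀ x {g h : Exponent → ℚ} → (∀ u → g u ≡ h u) → ⟨ x , g ⟩ ≡ ⟨ x , h ⟩
  ⟨⟩-cong x g≗h = sumBy-cong x (λ (c , F) → cong (c *_) (ev-cong (corollaF F) g≗h))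

  ⟨⟩-zero : ∀ x → ⟨ x , (λ _ → 0ℚ) ⟩ ≡ 0ℚ
  ⟨⟩-zero x = sumBy-zero x (λ (c , F) → trans (cong (c *_) (ev-zero (corollaF F))) (ℚ.*-zeroʳ c))

  ⟨⟩-+ : ∀ x (g h : Exponent → ℚ) → ⟨ x , (λ u → g u + h u) ⟩ ≡ ⟨ x , g ⟩ + ⟨ x , h ⟩
  ⟨⟩-+ x g h = trans (sumBy-cong x (λ (c , F) → trans (cong (c *_) (ev-+ g h (corollaF F))) (ℚ.*-distribˡ-+ c _ _)))
                     (sumBy-+ x _ _)

  ⟨⟩-*ˡ : ∀ x c (g : Exponent → ℚ) → ⟨ x , (λ u → c * g u) ⟩ ≡ c * ⟨ x , g ⟩
  ⟨⟩-*ˡ x c g = trans (sumBy-cong x (λ (d , F) → trans (cong (d *_) (ev-*ˡ c g (corollaF F))) (ℚ*.x∙yz≈y∙xz d c _)))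
                      (sumBy-*ˡ c x _)

  ⟨⟩-neg : ∀ x (g : Exponent → ℚ) → ⟨ x , (λ u → - g u) ⟩ ≡ - ⟨ x , g ⟩
  ⟨⟩-neg x g = begin
    ⟨ x , (λ u → - g u) ⟩          ≡⟨ ⟨⟩-cong x (λ u → ℚ-ring.-1*x≈-x (g u)) ⟨
    ⟨ x , (λ u → - 1ℚ * g u) ⟩     ≡⟨ ⟨⟩-*ˡ x (- 1ℚ) g ⟩
    - 1ℚ * ⟨ x , g ⟩               ≡⟨ ℚ-ring.-1*x≈-x _ ⟩
    - ⟨ x , g ⟩                    ∎
    where open ≡-Reasoning

  ⟨⟩-sumBy : ∀ x (xs : List A) (f : A → Exponent → ℚ) →
             ⟨ x , (λ u → sumBy xs (λ y → f y u)) ⟩ ≡ sumBy xs (λ y → ⟨ x , f y ⟩)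
  ⟨⟩-sumBy x xs f =
    trans (sumBy-cong x (λ (c , F) → trans (cong (c *_) (ev-sumBy xs f (corollaF F))) (sym (sumBy-*ˡ c xs _))))
          (sumBy-swap x xs _)

  ⟨⟩-scale : ∀ c x g → ⟨ scale c x , g ⟩ ≡ c * ⟨ x , g ⟩
  ⟨⟩-scale c x g = trans (sumBy-map _ x _) (trans (sumBy-cong x (λ (d , F) → ℚ.*-assoc c d _)) (sumBy-*ˡ c x _))

  ⟨⟩-concatMap : ∀ (f : A → LinComb) xs g → ⟨ concatMap f xs , g ⟩ ≡ sumBy xs (λ y → ⟨ f y , g ⟩)
  ⟨⟩-concatMap f xs g = sumBy-concatMap f xs _

  ⟨⟩-forest : ∀ F g → ⟨ forestL F , g ⟩ ≡ ev g (corollaF F)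
  ⟨⟩-forest F g = trans (ℚ.+-identityʳ _) (ℚ.*-identityˡ _)

  -- shift g a is the transpose of multiplication by the monomial a.
  shift : (Exponent → ℚ) → Maybe Exponent → Exponent → ℚ
  shift g a u = ev (λ v → g (u +ᵛ v)) a

  ⟨⟩-mulL : ∀ x y g → ⟨ mulL x y , g ⟩ ≡ ⟨ x , (λ u → ⟨ y , (λ v → g (u +ᵛ v)) ⟩) ⟩
  ⟨⟩-mulL x y g = trans (sumBy-concatMap _ x _) (sumBy-cong x (λ (c , F) → products c F))
    where
    open ≡-Reasoning
    products : ∀ c F → sumBy (map (λ (d , G) → (c * d , F ++ G)) y) (λ (e , H) → e * ev g (corollaF H))
                       ≡ c * ev (λ u → ⟨ y , (λ v → g (u +ᵛ v)) ⟩) (corollaF F)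
    products c F = begin
      sumBy (map _ y) (λ (e , H) → e * ev g (corollaF H))
        ≡⟨ sumBy-map _ y _ ⟩
      sumBy y (λ (d , G) → (c * d) * ev g (corollaF (F ++ G)))
        ≡⟨ sumBy-cong y (λ (d , G) → cong ((c * d) *_)
             (trans (cong (ev g) (corollaF-++ F G)) (ev-⊕ g (corollaF F) (corollaF G)))) ⟩
      sumBy y (λ (d , G) → (c * d) * ev (λ u → shift g (corollaF G) u) (corollaF F))
        ≡⟨ sumBy-cong y (λ (d , G) → trans (ℚ.*-assoc c d _) (cong (c *_) (sym (ev-*ˡ d _ (corollaF F))))) ⟩
      sumBy y (λ (d , G) → c * ev (λ u → d * shift g (corollaF G) u) (corollaF F))
        ≡⟨ sumBy-*ˡ c y _ ⟩
      c * sumBy y (λ (d , G) → ev (λ u → d * shift g (corollaF G) u) (corollaF F))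
        ≡⟨ cong (c *_) (ev-sumBy y (λ (d , G) u → d * shift g (corollaF G) u) (corollaF F)) ⟨
      c * ev (λ u → ⟨ y , (λ v → g (u +ᵛ v)) ⟩) (corollaF F) ∎

  ev-⟨⟩ : ∀ x (G : Exponent → Exponent → ℚ) a → ev (λ v → ⟨ x , G v ⟩) a ≡ ⟨ x , (λ u → ev (λ v → G v u) a) ⟩
  ev-⟨⟩ x G nothing  = sym (⟨⟩-zero x)
  ev-⟨⟩ x G (just _) = refl

  -- 𝒮 F observes the antipode S(F), and cutObs g (P , R) observes S(P) R.
  𝒮 : Forest → (Exponent → ℚ) → ℚ
  𝒮 F g = ⟨ antipode F , g ⟩

  cutObs : (Exponent → ℚ) → Forest × Forest → ℚ
  cutObs g (P , R) = 𝒮 P (shift g (corollaF R))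

  𝒮-[] : ∀ g → 𝒮 [] g ≡ g 0ᵛ
  𝒮-[] g = trans (ℚ.+-identityʳ _) (ℚ.*-identityˡ _)

  cutObs-total : ∀ F g → cutObs g (F , []) ≡ 𝒮 F g
  cutObs-total F g = ⟨⟩-cong (antipode F) (λ u → cong g (+ᵛ-identityʳ u))

  cutObs-cong : ∀ {g h : Exponent → ℚ} c → (∀ u → g u ≡ h u) → cutObs g c ≡ cutObs h c
  cutObs-cong (P , R) g≗h = ⟨⟩-cong (antipode P) (λ u → ev-cong (corollaF R) (λ v → g≗h (u +ᵛ v)))

  cutObs-zero : ∀ c → cutObs (λ _ → 0ℚ) c ≡ 0ℚ
  cutObs-zero (P , R) = trans (⟨⟩-cong (antipode P) (λ u → ev-zero (corollaF R))) (⟨⟩-zero (antipode P))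

  cutObs-sumBy : ∀ (xs : List A) (f : A → Exponent → ℚ) c →
                 sumBy xs (λ x → cutObs (f x) c) ≡ cutObs (λ u → sumBy xs (λ x → f x u)) c
  cutObs-sumBy xs f (P , R) = trans (sym (⟨⟩-sumBy (antipode P) xs (λ x → shift (f x) (corollaF R))))
    (⟨⟩-cong (antipode P) (λ u → sym (ev-sumBy xs (λ x v → f x (u +ᵛ v)) (corollaF R))))

  𝒮-trunkCuts : ∀ t ts g → 𝒮 (t ∷ ts) g ≡ - sumBy (trunkCuts (t ∷ ts)) (cutObs g)
  𝒮-trunkCuts (node us) ts g = begin
    ⟨ antipodeF (suc k) F , g ⟩
      ≡⟨ cong ⟨_, g ⟩ (antipodeF-suc k F) ⟩
    ⟨ negL (concatMap (antipodeTerm k) (cutsF F)) , g ⟩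
      ≡⟨ ⟨⟩-scale (- 1ℚ) (concatMap (antipodeTerm k) (cutsF F)) g ⟩
    - 1ℚ * ⟨ concatMap (antipodeTerm k) (cutsF F) , g ⟩
      ≡⟨ cong (- 1ℚ *_) (⟨⟩-concatMap (antipodeTerm k) (cutsF F) g) ⟩
    - 1ℚ * sumBy (cutsF F) (λ c → ⟨ antipodeTerm k c , g ⟩)
      ≡⟨ cong (λ cs → - 1ℚ * sumBy cs (λ c → ⟨ antipodeTerm k c , g ⟩)) (cutsF-total F) ⟩
    - 1ℚ * (0ℚ + sumBy (trunkCuts F) (λ c → ⟨ antipodeTerm k c , g ⟩))
      ≡⟨ cong (- 1ℚ *_) (trans (ℚ.+-identityˡ _) (sumBy-cong-All (trunkCuts-isTrunkCut F) trunkCut)) ⟩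
    - 1ℚ * sumBy (trunkCuts F) (cutObs g)
      ≡⟨ ℚ-ring.-1*x≈-x _ ⟩
    - sumBy (trunkCuts F) (cutObs g) ∎
    where
    open ≡-Reasoning
    F : Forest
    k : ℕ
    F = node us ∷ ts
    k = sizeF us ℕ.+ sizeF ts
    trunkCut : ∀ {c} → IsTrunkCut F c → ⟨ antipodeTerm k c , g ⟩ ≡ cutObs g c
    trunkCut {P , r ∷ R} (e , nonEmpty) = begin
      ⟨ mulL (antipodeF k P) (forestL (r ∷ R)) , g ⟩
        ≡⟨ cong (λ x → ⟨ mulL x (forestL (r ∷ R)) , g ⟩)
                (antipodeF-stable P (ℕ.≤-pred (pruned-< F P (r ∷ R) e nonEmpty))) ⟩
      ⟨ mulL (antipode P) (forestL (r ∷ R)) , g ⟩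
        ≡⟨ ⟨⟩-mulL (antipode P) (forestL (r ∷ R)) g ⟩
      ⟨ antipode P , (λ u → ⟨ forestL (r ∷ R) , (λ v → g (u +ᵛ v)) ⟩) ⟩
        ≡⟨ ⟨⟩-cong (antipode P) (λ u → ⟨⟩-forest (r ∷ R) _) ⟩
      cutObs g (P , r ∷ R) ∎

  antipode-cuts : ∀ F → NonEmpty F → ∀ g → sumBy (cutsF F) (cutObs g) ≡ 0ℚ
  antipode-cuts (t ∷ ts) nonEmpty g = begin
    sumBy (cutsF F) (cutObs g)
      ≡⟨ cong (λ cs → sumBy cs (cutObs g)) (cutsF-total F) ⟩
    cutObs g (F , []) + sumBy (trunkCuts F) (cutObs g)
      ≡⟨ cong (_+ sumBy (trunkCuts F) (cutObs g)) (trans (cutObs-total F g) (𝒮-trunkCuts t ts g)) ⟩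
    - sumBy (trunkCuts F) (cutObs g) + sumBy (trunkCuts F) (cutObs g)
      ≡⟨ ℚ.+-inverseˡ (sumBy (trunkCuts F) (cutObs g)) ⟩
    0ℚ ∎
    where
    open ≡-Reasoning
    F : Forest
    F = t ∷ ts

  -- cutObs² g c₁ c₂ observes S(P₁) R₁ S(P₂) R₂.
  cutObs² : (Exponent → ℚ) → Forest × Forest → Forest × Forest → ℚ
  cutObs² g c₁ c₂ = cutObs (λ u → cutObs (λ v → g (u +ᵛ v)) c₂) c₁

  sumBy-cutObs² : ∀ F G → NonEmpty G → ∀ g → sumBy (cutsF F) (λ c₁ → sumBy (cutsF G) (cutObs² g c₁)) ≡ 0ℚ
  sumBy-cutObs² F G ne g = sumBy-zero (cutsF F) (λ c₁ → begin
    sumBy (cutsF G) (cutObs² g c₁)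
      ≡⟨ cutObs-sumBy (cutsF G) (λ c₂ u → cutObs (λ v → g (u +ᵛ v)) c₂) c₁ ⟩
    cutObs (λ u → sumBy (cutsF G) (cutObs (λ v → g (u +ᵛ v)))) c₁
      ≡⟨ cutObs-cong c₁ (λ u → antipode-cuts G ne (λ v → g (u +ᵛ v))) ⟩
    cutObs (λ _ → 0ℚ) c₁
      ≡⟨ cutObs-zero c₁ ⟩
    0ℚ ∎)
    where open ≡-Reasoning

  cutObs-· : ∀ P₁ R₁ P₂ R₂ g → (∀ h → 𝒮 (P₁ ++ P₂) h ≡ 𝒮 P₁ (λ u → 𝒮 P₂ (λ v → h (u +ᵛ v)))) →
             cutObs g ((P₁ , R₁) · (P₂ , R₂)) ≡ cutObs² g (P₁ , R₁) (P₂ , R₂)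
  cutObs-· P₁ R₁ P₂ R₂ g 𝒮-P₁P₂ = begin
    𝒮 (P₁ ++ P₂) (shift g (corollaF (R₁ ++ R₂)))
      ≡⟨ 𝒮-P₁P₂ _ ⟩
    𝒮 P₁ (λ u → 𝒮 P₂ (λ v → shift g (corollaF (R₁ ++ R₂)) (u +ᵛ v)))
      ≡⟨ ⟨⟩-cong (antipode P₁) (λ u → trans (⟨⟩-cong (antipode P₂) (λ v → shift-++ u v))
                                            (sym (ev-⟨⟩ (antipode P₂) _ (corollaF R₁)))) ⟩
    cutObs² g (P₁ , R₁) (P₂ , R₂) ∎
    where
    open ≡-Reasoning
    shift-++ : ∀ u v → shift g (corollaF (R₁ ++ R₂)) (u +ᵛ v)
                       ≡ ev (λ w₁ → ev (λ w₂ → g ((u +ᵛ w₁) +ᵛ (v +ᵛ w₂))) (corollaF R₂)) (corollaF R₁)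
    shift-++ u v = begin
      ev (λ w → g ((u +ᵛ v) +ᵛ w)) (corollaF (R₁ ++ R₂))
        ≡⟨ cong (ev (λ w → g ((u +ᵛ v) +ᵛ w))) (corollaF-++ R₁ R₂) ⟩
      ev (λ w → g ((u +ᵛ v) +ᵛ w)) (corollaF R₁ ⊕ corollaF R₂)
        ≡⟨ ev-⊕ _ (corollaF R₁) (corollaF R₂) ⟩
      ev (λ w₁ → ev (λ w₂ → g ((u +ᵛ v) +ᵛ (w₁ +ᵛ w₂))) (corollaF R₂)) (corollaF R₁)
        ≡⟨ ev-cong (corollaF R₁) (λ w₁ → ev-cong (corollaF R₂) (λ w₂ → cong g (+ᵛ-interchange u v w₁ w₂))) ⟩
      ev (λ w₁ → ev (λ w₂ → g ((u +ᵛ w₁) +ᵛ (v +ᵛ w₂))) (corollaF R₂)) (corollaF R₁) ∎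

  sumBy-cutsF² : ∀ F G (X : Forest × Forest → Forest × Forest → ℚ) →
    sumBy (cutsF F) (λ c₁ → sumBy (cutsF G) (X c₁)) ≡
    X (F , []) (G , []) + (sumBy (trunkCuts G) (X (F , [])) + sumBy (trunkCuts F) (λ c₁ → sumBy (cutsF G) (X c₁)))
  sumBy-cutsF² F G X rewrite cutsF-total F | cutsF-total G =
    ℚ.+-assoc (X (F , []) (G , [])) (sumBy (trunkCuts G) (X (F , []))) _

  𝒮-++-upTo : ℕ → Set
  𝒮-++-upTo k = ∀ F G → sizeF F ℕ.+ sizeF G ≤ k → ∀ g → 𝒮 (F ++ G) g ≡ 𝒮 F (λ u → 𝒮 G (λ v → g (u +ᵛ v)))

  -- S(FG) and S(F) S(G) satisfy the same cut recursion: the cut sums of both vanish, and by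
  -- induction all their terms agree except the total cut of F and G, where they are the two sides.
  𝒮-++-step : ∀ k → 𝒮-++-upTo k → ∀ F G → NonEmpty F → NonEmpty G → sizeF F ℕ.+ sizeF G ≤ suc k →
              ∀ g → 𝒮 (F ++ G) g ≡ 𝒮 F (λ u → 𝒮 G (λ v → g (u +ᵛ v)))
  𝒮-++-step k IH F G neF neG FG≤ g = begin
    𝒮 (F ++ G) g                                 ≡⟨ ℚ-group.inverseˡ-unique _ _ (trans (sym whole-cutsF) cuts-FG) ⟩
    - rest (λ c₁ c₂ → cutObs g (c₁ · c₂))        ≡⟨ cong -_ (cong₂ _+_ trunks-of-G trunks-of-F) ⟩
    - rest (cutObs² g)                           ≡⟨ ℚ-group.inverseˡ-unique _ _ (trans (sym whole-cutsF²) cuts²) ⟨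
    𝒮 F (λ u → 𝒮 G (λ v → g (u +ᵛ v)))          ∎
    where
    open ≡-Reasoning
    rest : (Forest × Forest → Forest × Forest → ℚ) → ℚ
    rest X = sumBy (trunkCuts G) (X (F , [])) + sumBy (trunkCuts F) (λ c₁ → sumBy (cutsF G) (X c₁))
    whole-cutsF : sumBy (cutsF (F ++ G)) (cutObs g) ≡ 𝒮 (F ++ G) g + rest (λ c₁ c₂ → cutObs g (c₁ · c₂))
    whole-cutsF = trans (sumBy-cutsF-++ F G (cutObs g))
      (trans (sumBy-cutsF² F G _) (cong (_+ rest (λ c₁ c₂ → cutObs g (c₁ · c₂))) (cutObs-total (F ++ G) g)))
    cuts-FG : sumBy (cutsF (F ++ G)) (cutObs g) ≡ 0ℚ
    cuts-FG = antipode-cuts (F ++ G) (nonEmpty-++ neF) g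
    whole-cutsF² : sumBy (cutsF F) (λ c₁ → sumBy (cutsF G) (cutObs² g c₁))
                   ≡ 𝒮 F (λ u → 𝒮 G (λ v → g (u +ᵛ v))) + rest (cutObs² g)
    whole-cutsF² = trans (sumBy-cutsF² F G (cutObs² g)) (cong (_+ rest (cutObs² g))
      (trans (cutObs-total F _) (⟨⟩-cong (antipode F) (λ u → cutObs-total G (λ v → g (u +ᵛ v))))))
    cuts² : sumBy (cutsF F) (λ c₁ → sumBy (cutsF G) (cutObs² g c₁)) ≡ 0ℚ
    cuts² = sumBy-cutObs² F G neG g
    trunks-of-G : sumBy (trunkCuts G) (λ c₂ → cutObs g ((F , []) · c₂)) ≡ sumBy (trunkCuts G) (cutObs² g (F , []))
    trunks-of-G = sumBy-cong-All (trunkCuts-isTrunkCut G) (λ { {P₂ , R₂} (e , ne) →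
      cutObs-· F [] P₂ R₂ g (IH F P₂ (ℕ.≤-pred (ℕ.<-≤-trans (ℕ.+-monoʳ-< (sizeF F) (pruned-< G P₂ R₂ e ne)) FG≤))) })
    trunks-of-F : sumBy (trunkCuts F) (λ c₁ → sumBy (cutsF G) (λ c₂ → cutObs g (c₁ · c₂)))
                  ≡ sumBy (trunkCuts F) (λ c₁ → sumBy (cutsF G) (cutObs² g c₁))
    trunks-of-F = sumBy-cong-All (trunkCuts-isTrunkCut F) (λ { {P₁ , R₁} (e₁ , ne) →
      sumBy-cong-All (cutsF-isCut G) (λ { {P₂ , R₂} e₂ →
        cutObs-· P₁ R₁ P₂ R₂ g (IH P₁ P₂ (ℕ.≤-pred (ℕ.<-≤-trans
          (ℕ.+-mono-<-≤ (pruned-< F P₁ R₁ e₁ ne) (ℕ.≤-trans (ℕ.m≤m+n (sizeF P₂) (sizeF R₂)) (ℕ.≤-reflexive e₂)))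
          FG≤))) }) })

  𝒮-++-≤ : ∀ k → 𝒮-++-upTo k
  𝒮-++-≤ _       []            G             _   g =
    trans (⟨⟩-cong (antipode G) (λ v → cong g (sym (+ᵛ-identityˡ v)))) (sym (𝒮-[] (λ u → 𝒮 G (λ v → g (u +ᵛ v)))))
  𝒮-++-≤ _       F@(_ ∷ _)     []            _   g =
    trans (cong (λ F′ → 𝒮 F′ g) (List.++-identityʳ F))
          (⟨⟩-cong (antipode F) (λ u → trans (cong g (sym (+ᵛ-identityʳ u))) (sym (𝒮-[] (λ v → g (u +ᵛ v))))))
  𝒮-++-≤ zero    (node _ ∷ _)  (node _ ∷ _)  ()
  𝒮-++-≤ (suc k) F@(_ ∷ _)     G@(_ ∷ _)     FG≤ = 𝒮-++-step k (𝒮-++-≤ k) F G nonEmpty nonEmpty FG≤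

  𝒮-++ : ∀ F G g → 𝒮 (F ++ G) g ≡ 𝒮 F (λ u → 𝒮 G (λ v → g (u +ᵛ v)))
  𝒮-++ F G = 𝒮-++-≤ _ F G ℕ.≤-refl

  ev-corolla-suc : ∀ (h : Exponent → ℚ) l →
                   ev h (Maybe.map suc l >>= unitVec (suc n)) ≡ ev (graftDual h) (l >>= unitVec (suc n))
  ev-corolla-suc h nothing  = refl
  ev-corolla-suc h (just k) = graftDual-unitVec (suc n) k h

  -- Grafting ∘ onto a root turns c_k into c_{k+1}; grafting it anywhere else never gives a corolla.
  sumBy-graftLeafT-corollaT : ∀ t (h : Exponent → ℚ) →
    sumBy (graftLeafT t) (λ t′ → ev h (corollaT t′)) ≡ ev (graftDual h) (corollaT t)
  sumBy-graftLeafT-corollaT (node us) h = begin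
    ev h (corollaT (node (us ++ leaf ∷ []))) + sumBy (map node (graftLeaf us)) (λ t′ → ev h (corollaT t′))
      ≡⟨ cong₂ _+_ (cong (λ l → ev h (l >>= unitVec (suc n))) (leafCount-∷ʳ us))
                   (trans (sumBy-map node (graftLeaf us) _)
                          (sumBy-cong-All (graftLeaf-leafCount us) (λ e → cong (λ l → ev h (l >>= unitVec (suc n))) e))) ⟩
    ev h (Maybe.map suc (leafCount us) >>= unitVec (suc n)) + sumBy (graftLeaf us) (λ _ → 0ℚ)
      ≡⟨ cong₂ _+_ (ev-corolla-suc h (leafCount us)) (sumBy-zero (graftLeaf us) (λ _ → refl)) ⟩
    ev (graftDual h) (corollaT (node us)) + 0ℚ
      ≡⟨ ℚ.+-identityʳ _ ⟩
    ev (graftDual h) (corollaT (node us)) ∎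
    where open ≡-Reasoning

  sumBy-graftLeaf-corollaF : ∀ F (h : Exponent → ℚ) →
    sumBy (graftLeaf F) (λ G → ev h (corollaF G)) ≡ ev (graftDual h) (corollaF F)
  sumBy-graftLeaf-corollaF []       h = sym (graftDual-0ᵛ h)
  sumBy-graftLeaf-corollaF (t ∷ ts) h = begin
    sumBy (graftLeaf (t ∷ ts)) (λ G → ev h (corollaF G))
      ≡⟨ sumBy-graftLeaf-∷ t ts (λ G → ev h (corollaF G)) ⟩
    sumBy (graftLeafT t) (λ t′ → ev h (corollaT t′ ⊕ b)) + sumBy (graftLeaf ts) (λ G → ev h (a ⊕ corollaF G))
      ≡⟨ cong₂ _+_ (trans (sumBy-cong (graftLeafT t) (λ t′ → ev-⊕ h (corollaT t′) b))
                          (sumBy-graftLeafT-corollaT t (shift h b)))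
                   (trans (sumBy-cong (graftLeaf ts) (λ G →
                            trans (ev-⊕ h a (corollaF G)) (ev-swap (λ u v → h (u +ᵛ v)) a (corollaF G))))
                          (sumBy-graftLeaf-corollaF ts (λ v → ev (λ u → h (u +ᵛ v)) a))) ⟩
    ev (graftDual (shift h b)) a + ev (graftDual (λ v → ev (λ u → h (u +ᵛ v)) a)) b
      ≡⟨ cong₂ _+_ (ev-cong a (λ u → graftDual-ev (λ u′ v → h (u′ +ᵛ v)) b u))
                   (trans (ev-cong b (λ v → graftDual-ev (λ v′ u → h (u +ᵛ v′)) a v))
                          (sym (ev-swap (λ u v → graftDual (λ v′ → h (u +ᵛ v′)) v) a b))) ⟩
    ev (λ u → ev (λ v → graftDual (λ u′ → h (u′ +ᵛ v)) u) b) a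
      + ev (λ u → ev (λ v → graftDual (λ v′ → h (u +ᵛ v′)) v) b) a
      ≡⟨ trans (ev-cong a (λ u → ev-+ _ _ b)) (ev-+ _ _ a) ⟨
    ev (λ u → ev (λ v → graftDual (λ u′ → h (u′ +ᵛ v)) u + graftDual (λ v′ → h (u +ᵛ v′)) v) b) a
      ≡⟨ ev-cong a (λ u → ev-cong b (λ v → graftDual-+ᵛ h u v)) ⟨
    ev (λ u → ev (λ v → graftDual h (u +ᵛ v)) b) a
      ≡⟨ ev-⊕ (graftDual h) a b ⟨
    ev (graftDual h) (corollaF (t ∷ ts)) ∎
    where
    open ≡-Reasoning
    a b : Maybe Exponent
    a = corollaT t
    b = corollaF ts

  e₀ : Exponent
  e₀ = 1 ∷ 0ᵛ

  -- leafDual is the transpose of multiplication by the corolla c_0 = ∘.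
  leafDual : (Exponent → ℚ) → Exponent → ℚ
  leafDual g u = g (e₀ +ᵛ u)

  𝒮-leaf : ∀ h → 𝒮 (leaf ∷ []) h ≡ - h e₀
  𝒮-leaf h = trans (ℚ.+-identityʳ _) (trans (ℚ-ring.-1*x≈-x _) (cong (λ u → - h u) (+ᵛ-identityʳ e₀)))

  𝒮-leaf∷ : ∀ F h → 𝒮 (leaf ∷ F) h ≡ - 𝒮 F (leafDual h)
  𝒮-leaf∷ F h = trans (𝒮-++ (leaf ∷ []) F h) (𝒮-leaf (λ u → 𝒮 F (λ v → h (u +ᵛ v))))

  𝒮-leaf-comm : ∀ X Y h → 𝒮 (X ++ leaf ∷ Y) h ≡ 𝒮 (leaf ∷ X ++ Y) h
  𝒮-leaf-comm X Y h = begin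
    𝒮 (X ++ leaf ∷ Y) h                                  ≡⟨ 𝒮-++ X (leaf ∷ Y) h ⟩
    𝒮 X (λ u → 𝒮 (leaf ∷ Y) (λ v → h (u +ᵛ v)))          ≡⟨ ⟨⟩-cong (antipode X) (λ u → 𝒮-leaf∷ Y (λ v → h (u +ᵛ v))) ⟩
    𝒮 X (λ u → - 𝒮 Y (λ v → h (u +ᵛ (e₀ +ᵛ v))))         ≡⟨ ⟨⟩-neg (antipode X) _ ⟩
    - 𝒮 X (λ u → 𝒮 Y (λ v → h (u +ᵛ (e₀ +ᵛ v))))         ≡⟨ cong -_ (⟨⟩-cong (antipode X) (λ u → ⟨⟩-cong (antipode Y) (λ v →
                                                              cong h (swap-e₀ u v)))) ⟩
    - 𝒮 X (λ u → 𝒮 Y (λ v → leafDual h (u +ᵛ v)))        ≡⟨ cong -_ (𝒮-++ X Y (leafDual h)) ⟨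
    - 𝒮 (X ++ Y) (leafDual h)                             ≡⟨ 𝒮-leaf∷ (X ++ Y) h ⟨
    𝒮 (leaf ∷ X ++ Y) h                                   ∎
    where
    open ≡-Reasoning
    swap-e₀ : ∀ u v → u +ᵛ (e₀ +ᵛ v) ≡ e₀ +ᵛ (u +ᵛ v)
    swap-e₀ u v = trans (sym (+ᵛ-assoc u e₀ v)) (trans (cong (_+ᵛ v) (+ᵛ-comm u e₀)) (+ᵛ-assoc e₀ u v))

  shift-graftDual : ∀ (g : Exponent → ℚ) a u →
    shift (graftDual g) a u ≡ graftDual (shift g a) u + ev (graftDual (λ v → g (u +ᵛ v))) a
  shift-graftDual g nothing  u = sym (trans (ℚ.+-identityʳ _) (graftDual-zero u))
  shift-graftDual g (just v) u = graftDual-+ᵛ g u v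

  GraftFormula : Forest → Set
  GraftFormula F = ∀ g → sumBy (graftLeaf F) (λ G → 𝒮 G g) ≡ 𝒮 F (graftDual g) - natℚ (sizeF F) * 𝒮 F (leafDual g)

  graftCut-cutObs : ∀ g P R → GraftFormula P →
    graftCut (λ P R → cutObs g (P , R)) (P , R) ≡
    cutObs (graftDual g) (P , R) - natℚ (sizeF P ℕ.+ sizeF R) * cutObs (leafDual g) (P , R)
  graftCut-cutObs g P R graft-P = begin
    sumBy (graftLeaf P) (λ P′ → 𝒮 P′ (shift g r)) + sumBy (graftLeaf R) (λ R′ → cutObs g (P , R′))
      + natℚ (sizeF R) * 𝒮 (leaf ∷ P) (shift g r)
      ≡⟨ cong₂ _+_ (cong₂ _+_ (trans (graft-P (shift g r))
                                     (cong (λ z → 𝒮 P (graftDual (shift g r)) - natℚ (sizeF P) * z) leafDual-shift))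
                              grafted-trunk)
                   (cong (natℚ (sizeF R) *_) (trans (𝒮-leaf∷ P (shift g r)) (cong -_ leafDual-shift))) ⟩
    𝒮 P (graftDual (shift g r)) - natℚ (sizeF P) * y + 𝒮 P (λ u → ev (graftDual (λ v → g (u +ᵛ v))) r)
      + natℚ (sizeF R) * - y
      ≡⟨ rearrange (𝒮 P (graftDual (shift g r))) (natℚ (sizeF P)) y _ (natℚ (sizeF R)) ⟩
    (𝒮 P (graftDual (shift g r)) + 𝒮 P (λ u → ev (graftDual (λ v → g (u +ᵛ v))) r))
      - (natℚ (sizeF P) + natℚ (sizeF R)) * y
      ≡⟨ cong₂ _-_ (sym (trans (⟨⟩-cong (antipode P) (shift-graftDual g r)) (⟨⟩-+ (antipode P) _ _)))
                   (cong (_* y) (sym (natℚ-+ (sizeF P) (sizeF R)))) ⟩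
    cutObs (graftDual g) (P , R) - natℚ (sizeF P ℕ.+ sizeF R) * y ∎
    where
    open ≡-Reasoning
    open +-*-Solver
    r : Maybe Exponent
    y : ℚ
    r = corollaF R
    y = cutObs (leafDual g) (P , R)
    grafted-trunk : sumBy (graftLeaf R) (λ R′ → cutObs g (P , R′)) ≡ 𝒮 P (λ u → ev (graftDual (λ v → g (u +ᵛ v))) r)
    grafted-trunk = trans (sym (⟨⟩-sumBy (antipode P) (graftLeaf R) (λ R′ → shift g (corollaF R′))))
                          (⟨⟩-cong (antipode P) (λ u → sumBy-graftLeaf-corollaF R (λ v → g (u +ᵛ v))))
    leafDual-shift : 𝒮 P (leafDual (shift g r)) ≡ y
    leafDual-shift = ⟨⟩-cong (antipode P) (λ u → ev-cong r (λ v → cong g (+ᵛ-assoc e₀ u v)))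
    rearrange : ∀ a p y b q → a - p * y + b + q * - y ≡ (a + b) - (p + q) * y
    rearrange = solve 5 (λ a p y b q → a :- p :* y :+ b :+ q :* (:- y) := (a :+ b) :- (p :+ q) :* y) refl

  sumBy-trunkCuts-cutObs : ∀ t ts g → sumBy (trunkCuts (t ∷ ts)) (cutObs g) ≡ - 𝒮 (t ∷ ts) g
  sumBy-trunkCuts-cutObs t ts g =
    trans (sym (ℚ-group.⁻¹-involutive _)) (cong -_ (sym (𝒮-trunkCuts t ts g)))

  -- Each forest grafted from F has vanishing cut sum; regrouping these cut sums by the
  -- cuts of F (the cut formula for grafting) and using induction on the pruned parts
  -- leaves exactly the graft formula for F.
  graftFormula-≤ : ∀ k F → sizeF F ≤ k → GraftFormula F
  graftFormula-≤ _       []             _   g = sym (begin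
    𝒮 [] (graftDual g) - 0ℚ * 𝒮 [] (leafDual g)
      ≡⟨ cong₂ _-_ (trans (𝒮-[] (graftDual g)) (graftDual-0ᵛ g)) (ℚ.*-zeroˡ (𝒮 [] (leafDual g))) ⟩
    0ℚ - 0ℚ
      ≡⟨ ℚ.+-inverseʳ 0ℚ ⟩
    0ℚ ∎)
    where open ≡-Reasoning
  graftFormula-≤ zero    (node _ ∷ _)   ()
  graftFormula-≤ (suc k) F@(t ∷ ts)     F≤  g = begin
    Σgrafts
      ≡⟨ ℚ-group.inverseˡ-unique Σgrafts _ grafts+trunks≡0 ⟩
    - (- graftS - natℚ (sizeF F) * - leafS)
      ≡⟨ solve 3 (λ a c b → :- (:- a :- c :* :- b) := a :- c :* b) refl graftS (natℚ (sizeF F)) leafS ⟩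
    graftS - natℚ (sizeF F) * leafS ∎
    where
    open ≡-Reasoning
    open +-*-Solver
    Σgrafts graftS leafS : ℚ
    Σgrafts = sumBy (graftLeaf F) (λ G → 𝒮 G g)
    graftS = 𝒮 F (graftDual g)
    leafS = 𝒮 F (leafDual g)
    f : Forest → Forest → ℚ
    f P R = cutObs g (P , R)
    total : graftCut f (F , []) ≡ Σgrafts
    total = trans (graftCut-total f F) (sumBy-cong (graftLeaf F) (λ G → cutObs-total G g))
    trunks : sumBy (trunkCuts F) (graftCut f) ≡ - graftS - natℚ (sizeF F) * - leafS
    trunks = begin
      sumBy (trunkCuts F) (graftCut f)
        ≡⟨ sumBy-cong-All (trunkCuts-isTrunkCut F) (λ { {P , R} (e , ne) →
             trans (graftCut-cutObs g P R (graftFormula-≤ k P (ℕ.≤-pred (ℕ.<-≤-trans (pruned-< F P R e ne) F≤))))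
                   (cong (λ s → cutObs (graftDual g) (P , R) - natℚ s * cutObs (leafDual g) (P , R)) e) }) ⟩
      sumBy (trunkCuts F) (λ c → cutObs (graftDual g) c - natℚ (sizeF F) * cutObs (leafDual g) c)
        ≡⟨ sumBy-sub-*ˡ (trunkCuts F) (cutObs (graftDual g)) (natℚ (sizeF F)) (cutObs (leafDual g)) ⟩
      sumBy (trunkCuts F) (cutObs (graftDual g)) - natℚ (sizeF F) * sumBy (trunkCuts F) (cutObs (leafDual g))
        ≡⟨ cong₂ (λ a b → a - natℚ (sizeF F) * b) (sumBy-trunkCuts-cutObs t ts _) (sumBy-trunkCuts-cutObs t ts _) ⟩
      - graftS - natℚ (sizeF F) * - leafS ∎
    grafts+trunks≡0 : Σgrafts + (- graftS - natℚ (sizeF F) * - leafS) ≡ 0ℚ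
    grafts+trunks≡0 = begin
      Σgrafts + (- graftS - natℚ (sizeF F) * - leafS)
        ≡⟨ cong₂ _+_ total trunks ⟨
      graftCut f (F , []) + sumBy (trunkCuts F) (graftCut f)
        ≡⟨ cong (λ cs → sumBy cs (graftCut f)) (cutsF-total F) ⟨
      sumBy (cutsF F) (graftCut f)
        ≡⟨ sumBy-cutsF-graftLeaf F f (λ X Y R → 𝒮-leaf-comm X Y (shift g (corollaF R))) ⟨
      sumBy (graftLeaf F) (λ G → sumBy (cutsF G) (cutObs g))
        ≡⟨ sumBy-cong-All (graftLeaf-nonEmpty F) (λ ne → antipode-cuts _ ne g) ⟩
      sumBy (graftLeaf F) (λ _ → 0ℚ)
        ≡⟨ sumBy-zero (graftLeaf F) (λ _ → refl) ⟩
      0ℚ ∎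

  graftFormula : ∀ F → GraftFormula F
  graftFormula F = graftFormula-≤ (sizeF F) F ℕ.≤-refl

  ⟨S⟩ : ∀ x g → ⟨ S x , g ⟩ ≡ sumBy x (λ (c , F) → c * 𝒮 F g)
  ⟨S⟩ x g = trans (⟨⟩-concatMap _ x g) (sumBy-cong x (λ (c , F) → ⟨⟩-scale c (antipode F) g))

  ⟨graftL-leaf⟩ : ∀ x g → ⟨ graftL x (forestL (leaf ∷ [])) , g ⟩ ≡ ⟨ x , graftDual g ⟩
  ⟨graftL-leaf⟩ x g = trans (sumBy-graftL-leaf x (λ H → ev g (corollaF H)))
    (sumBy-cong x (λ (c , F) → cong (c *_) (sumBy-graftLeaf-corollaF F g)))

  ⟨S-δ-suc⟩ : ∀ k g → ⟨ S (δ (suc k)) , g ⟩ ≡ ⟨ S (δ k) , graftDual g ⟩ - natℚ (suc k) * ⟨ S (δ k) , leafDual g ⟩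
  ⟨S-δ-suc⟩ k g = begin
    ⟨ S (δ (suc k)) , g ⟩
      ≡⟨ ⟨S⟩ (δ (suc k)) g ⟩
    sumBy (δ (suc k)) (λ (c , H) → c * 𝒮 H g)
      ≡⟨ sumBy-graftL-leaf (δ k) (λ H → 𝒮 H g) ⟩
    sumBy (δ k) (λ (c , F) → c * sumBy (graftLeaf F) (λ H → 𝒮 H g))
      ≡⟨ sumBy-cong-All (δ-size k) (λ { {c , F} e →
           cong (c *_) (trans (graftFormula F g) (cong (λ s → 𝒮 F (graftDual g) - natℚ s * 𝒮 F (leafDual g)) e)) }) ⟩
    sumBy (δ k) (λ (c , F) → c * (𝒮 F (graftDual g) - natℚ (suc k) * 𝒮 F (leafDual g)))
      ≡⟨ sumBy-cong (δ k) (λ (c , F) → distribute c (𝒮 F (graftDual g)) (natℚ (suc k)) (𝒮 F (leafDual g))) ⟩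
    sumBy (δ k) (λ (c , F) → c * 𝒮 F (graftDual g) - natℚ (suc k) * (c * 𝒮 F (leafDual g)))
      ≡⟨ sumBy-sub-*ˡ (δ k) (λ (c , F) → c * 𝒮 F (graftDual g)) (natℚ (suc k)) (λ (c , F) → c * 𝒮 F (leafDual g)) ⟩
    sumBy (δ k) (λ (c , F) → c * 𝒮 F (graftDual g)) - natℚ (suc k) * sumBy (δ k) (λ (c , F) → c * 𝒮 F (leafDual g))
      ≡⟨ cong₂ (λ a b → a - natℚ (suc k) * b) (⟨S⟩ (δ k) (graftDual g)) (⟨S⟩ (δ k) (leafDual g)) ⟨
    ⟨ S (δ k) , graftDual g ⟩ - natℚ (suc k) * ⟨ S (δ k) , leafDual g ⟩ ∎
    where
    open ≡-Reasoning
    open +-*-Solver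
    distribute : ∀ c a m b → c * (a - m * b) ≡ c * a - m * (c * b)
    distribute = solve 4 (λ c a m b → c :* (a :- m :* b) := c :* a :- m :* (c :* b)) refl

  -- The projection of x is the single monomial a, or zero when a is nothing.
  record ProjectsTo (x : LinComb) (a : Maybe Exponent) : Set where
    constructor projectsTo
    field ⟨⟩-ev : ∀ g → ⟨ x , g ⟩ ≡ ev g a

  open ProjectsTo

  oneL-projectsTo : ProjectsTo oneL (just 0ᵛ)
  oneL-projectsTo = projectsTo (λ g → trans (ℚ.+-identityʳ _) (ℚ.*-identityˡ _))

  mulL-projectsTo : ∀ {x y a b} → ProjectsTo x a → ProjectsTo y b → ProjectsTo (mulL x y) (a ⊕ b)
  mulL-projectsTo {x} {y} {a} {b} x↦a y↦b = projectsTo (λ g →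
    trans (⟨⟩-mulL x y g) (trans (⟨⟩-ev x↦a _) (trans (ev-cong a (λ u → ⟨⟩-ev y↦b _)) (sym (ev-⊕ g a b)))))

  powL-projectsTo : ∀ {x a} → ProjectsTo x a → ∀ k → ProjectsTo (powL x k) (pow⊕ k a)
  powL-projectsTo x↦a zero    = oneL-projectsTo
  powL-projectsTo x↦a (suc k) = mulL-projectsTo x↦a (powL-projectsTo x↦a k)

  δ-projectsTo : ∀ k → ProjectsTo (δ k) (unitVec (suc n) k)
  δ-projectsTo zero    = projectsTo (λ g → trans (ℚ.+-identityʳ _) (trans (ℚ.*-identityˡ _) (cong g (+ᵛ-identityʳ e₀))))
  δ-projectsTo (suc k) = projectsTo (λ g →
    trans (⟨graftL-leaf⟩ (δ k) g) (trans (⟨⟩-ev (δ-projectsTo k) (graftDual g)) (sym (graftDual-unitVec (suc n) k g))))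

  monoFrom-projectsTo : ∀ {l} k (i : Vec ℕ l) → ProjectsTo (monoFrom k i) (monoExp k i)
  monoFrom-projectsTo k []       = oneL-projectsTo
  monoFrom-projectsTo k (x ∷ xs) = mulL-projectsTo (powL-projectsTo (δ-projectsTo k) x) (monoFrom-projectsTo (suc k) xs)

  ⟨expansion⟩ : ∀ m (a : Vec ℕ m → ℚ) g → ⟨ expansion m a , g ⟩ ≡ sumBy (tuples m) (λ i → a i * ev g (monoExp 0 i))
  ⟨expansion⟩ m a g = trans (⟨⟩-concatMap _ (tuples m) g)
    (sumBy-cong (tuples m) (λ i → trans (⟨⟩-scale (a i) (mono i) g) (cong (a i *_) (⟨⟩-ev (monoFrom-projectsTo 0 i) g))))

  corollaF-↭ : ∀ {F G} → F ↭ G → corollaF F ≡ corollaF G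
  corollaF-↭ Perm.refl        = refl
  corollaF-↭ (Perm.prep t p)  = cong (corollaT t ⊕_) (corollaF-↭ p)
  corollaF-↭ (Perm.swap {xs} {ys} s t p) = begin
    corollaT s ⊕ (corollaT t ⊕ corollaF xs)   ≡⟨ cong (λ a → corollaT s ⊕ (corollaT t ⊕ a)) (corollaF-↭ p) ⟩
    corollaT s ⊕ (corollaT t ⊕ corollaF ys)   ≡⟨ ⊕-assoc (corollaT s) (corollaT t) (corollaF ys) ⟨
    (corollaT s ⊕ corollaT t) ⊕ corollaF ys   ≡⟨ cong (_⊕ corollaF ys) (⊕-comm (corollaT s) (corollaT t)) ⟩
    (corollaT t ⊕ corollaT s) ⊕ corollaF ys   ≡⟨ ⊕-assoc (corollaT t) (corollaT s) (corollaF ys) ⟩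
    corollaT t ⊕ (corollaT s ⊕ corollaF ys)   ∎
    where open ≡-Reasoning
  corollaF-↭ (Perm.trans p q) = trans (corollaF-↭ p) (corollaF-↭ q)

  -- A reader for forest codes that accumulates the corolla exponent of the forest read
  -- so far, and fails as soon as it meets a vertex at depth two.
  data ReadState : Set where
    atRoots : Exponent → ReadState
    inTree  : Exponent → ℕ → ReadState
    inChild : Exponent → ℕ → ReadState

  mutual
    read : ReadState → List Bool → Maybe Exponent
    read (atRoots a)   []          = just a
    read (atRoots a)   (true ∷ w)  = read (inTree a 0) w
    read (atRoots a)   (false ∷ w) = nothing
    read (inTree a k)  []          = nothing
    read (inTree a k)  (true ∷ w)  = read (inChild a k) w
    read (inTree a k)  (false ∷ w) = readOn (unitVec (suc n) k) a w
    read (inChild a k) []          = nothing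
    read (inChild a k) (true ∷ w)  = nothing
    read (inChild a k) (false ∷ w) = read (inTree a (suc k)) w

    readOn : Maybe Exponent → Exponent → List Bool → Maybe Exponent
    readOn (just u) a w = read (atRoots (a +ᵛ u)) w
    readOn nothing  a w = nothing

  read-children : ∀ ts a k w → read (inTree a k) (concat (codesF ts) ++ false ∷ w)
                               ≡ readOn (Maybe.map (k ℕ.+_) (leafCount ts) >>= unitVec (suc n)) a w
  read-children []                  a k w = cong (λ j → readOn (unitVec (suc n) j) a w) (sym (ℕ.+-identityʳ k))
  read-children (node []      ∷ ts) a k w = trans (read-children ts a (suc k) w)
    (cong (λ l → readOn (l >>= unitVec (suc n)) a w) (shift-suc (leafCount ts)))
    where
    shift-suc : ∀ l → Maybe.map (suc k ℕ.+_) l ≡ Maybe.map (k ℕ.+_) (Maybe.map suc l)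
    shift-suc nothing  = refl
    shift-suc (just j) = cong just (sym (ℕ.+-suc k j))
  read-children (node (u ∷ us) ∷ ts) a k w with codeF-∷ u us
  ... | _ , e = cong (λ c → read (inChild a k) (((c ++ false ∷ []) ++ concat (codesF ts)) ++ false ∷ w)) e

  read-tree : ∀ t a w → read (atRoots a) (codeT t ++ w) ≡ readOn (corollaT t) a w
  read-tree (node ts) a w with sortCodes-↭ ts
  ... | ts′ , e , p = begin
    read (inTree a 0) ((codeF ts ++ false ∷ []) ++ w)
      ≡⟨ cong (read (inTree a 0)) (List.++-assoc (codeF ts) (false ∷ []) w) ⟩
    read (inTree a 0) (concat (sortCodes (codesF ts)) ++ false ∷ w)
      ≡⟨ cong (λ cs → read (inTree a 0) (concat cs ++ false ∷ w)) e ⟩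
    read (inTree a 0) (concat (codesF ts′) ++ false ∷ w)
      ≡⟨ read-children ts′ a 0 w ⟩
    readOn (Maybe.map (0 ℕ.+_) (leafCount ts′) >>= unitVec (suc n)) a w
      ≡⟨ cong (λ l → readOn (l >>= unitVec (suc n)) a w) (trans (Maybe.map-id (leafCount ts′)) (leafCount-↭ p)) ⟩
    readOn (corollaT (node ts)) a w ∎
    where open ≡-Reasoning

  read-forest : ∀ F a w → read (atRoots a) (concat (codesF F) ++ w) ≡ readOn (corollaF F) a w
  read-forest []      a w = cong (λ b → read (atRoots b) w) (sym (+ᵛ-identityʳ a))
  read-forest (t ∷ F) a w = trans (cong (read (atRoots a)) (List.++-assoc (codeT t) (concat (codesF F)) w))
    (trans (read-tree t a (concat (codesF F) ++ w)) (readOn-⊕ (corollaT t) (corollaF F) (λ b → read-forest F b w)))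
    where
    readOn-⊕ : ∀ s r → (∀ b → read (atRoots b) (concat (codesF F) ++ w) ≡ readOn r b w) →
               readOn s a (concat (codesF F) ++ w) ≡ readOn (s ⊕ r) a w
    readOn-⊕ nothing  r        _   = refl
    readOn-⊕ (just u) nothing  rest = rest (a +ᵛ u)
    readOn-⊕ (just u) (just v) rest = trans (rest (a +ᵛ u)) (cong (λ b → read (atRoots b) w) (+ᵛ-assoc a u v))

  decode : List Bool → Maybe Exponent
  decode = read (atRoots 0ᵛ)

  decode-codeF : ∀ F → decode (codeF F) ≡ corollaF F
  decode-codeF F with sortCodes-↭ F
  ... | F′ , e , p = begin
    decode (concat (sortCodes (codesF F)))  ≡⟨ cong (decode ∘ concat) e ⟩
    decode (concat (codesF F′))             ≡⟨ cong decode (List.++-identityʳ (concat (codesF F′))) ⟨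
    decode (concat (codesF F′) ++ [])       ≡⟨ read-forest F′ 0ᵛ [] ⟩
    readOn (corollaF F′) 0ᵛ []              ≡⟨ readOn-[] (corollaF F′) ⟩
    corollaF F′                             ≡⟨ corollaF-↭ p ⟩
    corollaF F                              ∎
    where
    open ≡-Reasoning
    readOn-[] : ∀ r → readOn r 0ᵛ [] ≡ r
    readOn-[] nothing  = refl
    readOn-[] (just u) = cong just (+ᵛ-identityˡ u)

  ⟨⟩-resp-≈ : ∀ x y → x ≈ y → ∀ g → ⟨ x , g ⟩ ≡ ⟨ y , g ⟩
  ⟨⟩-resp-≈ x y x≈y g = trans (via-codes x) (trans (sumCodes-resp-≈ (ev g ∘ decode) x y x≈y) (sym (via-codes y)))
    where
    via-codes : ∀ z → ⟨ z , g ⟩ ≡ sumCodes (ev g ∘ decode) z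
    via-codes z = sumBy-cong z (λ (c , F) → cong (λ a → c * ev g a) (sym (decode-codeF F)))

indicator : ∀ {m} → Vec ℕ m → Vec ℕ m → ℚ
indicator []       []       = 1ℚ
indicator (x ∷ xs) (y ∷ ys) = if x ℕ.≡ᵇ y then indicator xs ys else 0ℚ

≡ᵇ-refl : ∀ x → (x ℕ.≡ᵇ x) ≡ true
≡ᵇ-refl zero    = refl
≡ᵇ-refl (suc x) = ≡ᵇ-refl x

≡ᵇ-≢ : ∀ {x y} → x ≢ y → (x ℕ.≡ᵇ y) ≡ false
≡ᵇ-≢ {x} {y} x≢y with x ℕ.≡ᵇ y in e
... | true  = ⊥-elim (x≢y (ℕ.≡ᵇ⇒≡ x y (subst T (sym e) tt)))
... | false = refl

indicator-∷ʳ0 : ∀ {m} (u v : Vec ℕ m) → indicator (u ∷ʳ 0) (v ∷ʳ 0) ≡ indicator u v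
indicator-∷ʳ0 []       []       = refl
indicator-∷ʳ0 (x ∷ xs) (y ∷ ys) with x ℕ.≡ᵇ y
... | true  = indicator-∷ʳ0 xs ys
... | false = refl

sumBy-upTo-select : ∀ b s (H : ℕ → ℚ) → s < b → sumBy (upTo b) (λ x → if x ℕ.≡ᵇ s then H x else 0ℚ) ≡ H s
sumBy-upTo-select (suc b) s H s<1+b = begin
  sumBy (upTo (suc b)) F                ≡⟨ cong (λ xs → sumBy xs F) (List.upTo-∷ʳ b) ⟨
  sumBy (upTo b ++ b ∷ []) F            ≡⟨ sumBy-++ (upTo b) (b ∷ []) F ⟩
  sumBy (upTo b) F + (F b + 0ℚ)         ≡⟨ last-or-earlier (ℕ.m≤n⇒m<n∨m≡n (ℕ.≤-pred s<1+b)) ⟩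
  H s                                   ∎
  where
  open ≡-Reasoning
  F : ℕ → ℚ
  F x = if x ℕ.≡ᵇ s then H x else 0ℚ
  last-or-earlier : s < b ⊎ s ≡ b → sumBy (upTo b) F + (F b + 0ℚ) ≡ H s
  last-or-earlier (inj₁ s<b) rewrite ≡ᵇ-≢ (ℕ.>⇒≢ s<b) =
    trans (cong₂ _+_ (sumBy-upTo-select b s H s<b) (ℚ.+-identityʳ 0ℚ)) (ℚ.+-identityʳ _)
  last-or-earlier (inj₂ refl) rewrite ≡ᵇ-refl s =
    trans (cong₂ _+_ (sumBy-cong-All (ListAll.all-upTo s) (λ {x} x<s → cong (if_then H x else 0ℚ) (≡ᵇ-≢ (ℕ.<⇒≢ x<s))))
                     (ℚ.+-identityʳ (H s)))
          (trans (cong (_+ H s) (sumBy-zero (upTo s) (λ _ → refl))) (ℚ.+-identityˡ (H s)))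

sumBy-allVecs-indicator : ∀ b m (G : Vec ℕ m → ℚ) s → All (_≤ b) s →
                          sumBy (allVecs b m) (λ i → G i * indicator i s) ≡ G s
sumBy-allVecs-indicator b zero    G []       VecAll.[]  = trans (ℚ.+-identityʳ _) (ℚ.*-identityʳ _)
sumBy-allVecs-indicator b (suc m) G (x ∷ s) (x≤b VecAll.∷ s≤b) = begin
  sumBy (allVecs b (suc m)) (λ i → G i * indicator i (x ∷ s))
    ≡⟨ sumBy-concatMap (λ y → map (y ∷_) (allVecs b m)) (upTo (suc b)) _ ⟩
  sumBy (upTo (suc b)) (λ y → sumBy (map (y ∷_) (allVecs b m)) (λ i → G i * indicator i (x ∷ s)))
    ≡⟨ sumBy-cong (upTo (suc b)) (λ y → trans (sumBy-map (y ∷_) (allVecs b m) _) (first-entry y)) ⟩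
  sumBy (upTo (suc b)) (λ y → if y ℕ.≡ᵇ x then G (y ∷ s) else 0ℚ)
    ≡⟨ sumBy-upTo-select (suc b) x (λ y → G (y ∷ s)) (s≤s x≤b) ⟩
  G (x ∷ s) ∎
  where
  open ≡-Reasoning
  first-entry : ∀ y → sumBy (allVecs b m) (λ i → G (y ∷ i) * indicator (y ∷ i) (x ∷ s))
                      ≡ (if y ℕ.≡ᵇ x then G (y ∷ s) else 0ℚ)
  first-entry y with y ℕ.≡ᵇ x
  ... | true  = sumBy-allVecs-indicator b m (λ i → G (y ∷ i)) s s≤b
  ... | false = sumBy-zero (allVecs b m) (λ i → ℚ.*-zeroʳ (G (y ∷ i)))

wsFrom-bound : ∀ {m} j (s : Vec ℕ m) → All (_≤ wsFrom (suc j) s) s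
wsFrom-bound j []       = VecAll.[]
wsFrom-bound j (x ∷ xs) =
  ℕ.≤-trans (ℕ.m≤n*m x (suc j)) (ℕ.m≤m+n _ _)
    VecAll.∷ VecAll.map (λ p → ℕ.≤-trans p (ℕ.m≤n+m _ _)) (wsFrom-bound (suc j) xs)

sumBy-tuples-indicator : ∀ m (c : Vec ℕ m → ℚ) s → ws s ≡ m → sumBy (tuples m) (λ i → c i * indicator i s) ≡ c s
sumBy-tuples-indicator m c s ws≡m = begin
  sumBy (tuples m) (λ i → c i * indicator i s)
    ≡⟨ sumBy-filter (λ v → ws v ℕ.≟ m) (allVecs m m) _ ⟩
  sumBy (allVecs m m) (λ i → if does (ws i ℕ.≟ m) then c i * indicator i s else 0ℚ)
    ≡⟨ sumBy-cong (allVecs m m) restrict ⟩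
  sumBy (allVecs m m) (λ i → c′ i * indicator i s)
    ≡⟨ sumBy-allVecs-indicator m m c′ s (subst (λ k → All (_≤ k) s) ws≡m (wsFrom-bound 0 s)) ⟩
  c′ s
    ≡⟨ c′-s ⟩
  c s ∎
  where
  open ≡-Reasoning
  c′ : Vec ℕ m → ℚ
  c′ i = if does (ws i ℕ.≟ m) then c i else 0ℚ
  restrict : ∀ i → (if does (ws i ℕ.≟ m) then c i * indicator i s else 0ℚ) ≡ c′ i * indicator i s
  restrict i with does (ws i ℕ.≟ m)
  ... | true  = refl
  ... | false = sym (ℚ.*-zeroˡ (indicator i s))
  c′-s : c′ s ≡ c s
  c′-s rewrite ws≡m | ≡ᵇ-refl m = refl

wsFrom-∷ʳ : ∀ {m} j (v : Vec ℕ m) z → wsFrom j (v ∷ʳ z) ≡ wsFrom j v ℕ.+ (j ℕ.+ m) ℕ.* z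
wsFrom-∷ʳ j []      z = trans (ℕ.+-identityʳ _) (cong (ℕ._* z) (sym (ℕ.+-identityʳ j)))
wsFrom-∷ʳ {suc m} j (x ∷ v) z = begin
  j ℕ.* x ℕ.+ wsFrom (suc j) (v ∷ʳ z)                     ≡⟨ cong (j ℕ.* x ℕ.+_) (wsFrom-∷ʳ (suc j) v z) ⟩
  j ℕ.* x ℕ.+ (wsFrom (suc j) v ℕ.+ (suc j ℕ.+ m) ℕ.* z)  ≡⟨ ℕ.+-assoc (j ℕ.* x) _ _ ⟨
  j ℕ.* x ℕ.+ wsFrom (suc j) v ℕ.+ (suc j ℕ.+ m) ℕ.* z    ≡⟨ cong (λ k → W ℕ.+ k ℕ.* z) (ℕ.+-suc j m) ⟨
  j ℕ.* x ℕ.+ wsFrom (suc j) v ℕ.+ (j ℕ.+ suc m) ℕ.* z    ∎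
  where
  open ≡-Reasoning
  W : ℕ
  W = j ℕ.* x ℕ.+ wsFrom (suc j) v

ws-∷ʳ : ∀ {m} (v : Vec ℕ m) z → ws (v ∷ʳ z) ≡ ws v ℕ.+ suc m ℕ.* z
ws-∷ʳ v z = wsFrom-∷ʳ 1 v z

ws-∷ʳ0 : ∀ {m} (v : Vec ℕ m) → ws (v ∷ʳ 0) ≡ ws v
ws-∷ʳ0 {m} v = trans (ws-∷ʳ v 0) (trans (cong (ws v ℕ.+_) (ℕ.*-zeroʳ (suc m))) (ℕ.+-identityʳ (ws v)))

wsFrom-0ᵛ : ∀ {m} j → wsFrom j (0ᵛ {m}) ≡ 0
wsFrom-0ᵛ {zero}  j = refl
wsFrom-0ᵛ {suc m} j = trans (cong (ℕ._+ wsFrom (suc j) (0ᵛ {m})) (ℕ.*-zeroʳ j)) (wsFrom-0ᵛ {m} (suc j))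

ws-0ᵛ∷ʳ1 : ∀ m → ws (0ᵛ {m} ∷ʳ 1) ≡ suc m
ws-0ᵛ∷ʳ1 m = trans (ws-∷ʳ (0ᵛ {m}) 1) (trans (cong (ℕ._+ suc m ℕ.* 1) (wsFrom-0ᵛ {m} 1)) (ℕ.*-identityʳ (suc m)))

ws≡0⇒zeros : ∀ {m} (v : Vec ℕ m) → ws v ≡ 0 → All (_≡ 0) v
ws≡0⇒zeros v ws≡0 = VecAll.map (λ x≤ws → ℕ.n≤0⇒n≡0 (subst (_ ≤_) ws≡0 x≤ws)) (wsFrom-bound 0 v)

zeros⇒0ᵛ : ∀ {m} {v : Vec ℕ m} → All (_≡ 0) v → v ≡ 0ᵛ
zeros⇒0ᵛ VecAll.[]          = refl
zeros⇒0ᵛ (refl VecAll.∷ zs) = cong (0 ∷_) (zeros⇒0ᵛ zs)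

last-weight : ∀ m w z → w ℕ.+ suc m ℕ.* z ≡ suc m → z ≢ 1 → z ≡ 0
last-weight m w zero          _ _   = refl
last-weight m w (suc zero)    _ z≢1 = ⊥-elim (z≢1 refl)
last-weight m w (suc (suc z)) e _   = ⊥-elim (ℕ.<-irrefl (sym e) (begin-strict
  suc m                                    <⟨ ℕ.m<m+n (suc m) (s≤s z≤n) ⟩
  suc m ℕ.+ suc m ℕ.* suc z                ≡⟨ ℕ.*-suc (suc m) (suc z) ⟨
  suc m ℕ.* suc (suc z)                    ≤⟨ ℕ.m≤n+m _ w ⟩
  w ℕ.+ suc m ℕ.* suc (suc z)              ∎))
  where open ℕ.≤-Reasoning

-- The exponents s, with multiplicities c, whose image under the derivation contains w.
preimages : ∀ {m} → Vec ℕ m → List (ℚ × Vec ℕ m)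
preimages []              = []
preimages (x ∷ [])        = []
preimages (x ∷ zero ∷ r)  = map (map₂ (x ∷_)) (preimages (zero ∷ r))
preimages (x ∷ suc y ∷ r) = (natℚ x + 1ℚ , suc x ∷ y ∷ r) ∷ map (map₂ (x ∷_)) (preimages (suc y ∷ r))

preimages-∷ : ∀ {m} x x′ (w u : Vec ℕ m) →
  graftDual (λ v → indicator v w) u ≡ sumBy (preimages w) (λ (c , s) → c * indicator u s) →
  graftDual (λ v → indicator (x′ ∷ v) (x ∷ w)) u
  ≡ sumBy (map (map₂ (x ∷_)) (preimages w)) (λ (c , s) → c * indicator (x′ ∷ u) s)
preimages-∷ x x′ w u IH
  rewrite sumBy-map (map₂ (x ∷_)) (preimages w) (λ (c , s) → c * indicator (x′ ∷ u) s) with x′ ℕ.≡ᵇ x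
... | true  = IH
... | false = trans (graftDual-zero u) (sym (sumBy-zero (preimages w) (λ (c , s) → ℚ.*-zeroʳ c)))

graftDual-indicator : ∀ {m} (w u : Vec ℕ m) →
  graftDual (λ v → indicator v w) u ≡ sumBy (preimages w) (λ (c , s) → c * indicator u s)
graftDual-indicator []             []              = refl
graftDual-indicator (x ∷ [])       (x′ ∷ [])       = refl
graftDual-indicator (x ∷ zero ∷ r) (x′ ∷ y′ ∷ r′) =
  trans (cong (_+ graftDual (λ v → indicator (x′ ∷ v) (x ∷ zero ∷ r)) (y′ ∷ r′)) (no-preimage x′))
        (trans (ℚ.+-identityˡ _) (preimages-∷ x x′ (zero ∷ r) (y′ ∷ r′) (graftDual-indicator (zero ∷ r) (y′ ∷ r′))))
  where
  no-preimage : ∀ x′ → natℚ x′ * indicator (pred x′ ∷ suc y′ ∷ r′) (x ∷ zero ∷ r) ≡ 0ℚ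
  no-preimage x′ with pred x′ ℕ.≡ᵇ x
  ... | true  = ℚ.*-zeroʳ (natℚ x′)
  ... | false = ℚ.*-zeroʳ (natℚ x′)
graftDual-indicator (x ∷ suc y ∷ r) (x′ ∷ y′ ∷ r′) =
  cong₂ _+_ (first-preimage x′) (preimages-∷ x x′ (suc y ∷ r) (y′ ∷ r′) (graftDual-indicator (suc y ∷ r) (y′ ∷ r′)))
  where
  first-preimage : ∀ x′ → natℚ x′ * indicator (pred x′ ∷ suc y′ ∷ r′) (x ∷ suc y ∷ r)
                          ≡ (natℚ x + 1ℚ) * indicator (x′ ∷ y′ ∷ r′) (suc x ∷ y ∷ r)
  first-preimage zero     = trans (ℚ.*-zeroˡ (indicator (0 ∷ suc y′ ∷ r′) (x ∷ suc y ∷ r))) (sym (ℚ.*-zeroʳ (natℚ x + 1ℚ)))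
  first-preimage (suc x″) with x″ ℕ.≡ᵇ x in e
  ... | true  = cong (_* _) (trans (natℚ-suc x″) (cong (λ z → natℚ z + 1ℚ) (ℕ.≡ᵇ⇒≡ x″ x (subst T (sym e) tt))))
  ... | false = trans (ℚ.*-zeroʳ (natℚ (suc x″))) (sym (ℚ.*-zeroʳ (natℚ x + 1ℚ)))

sumℚ-map-tabulate-suc : ∀ {k} (f : Fin.Fin (suc k) → ℚ) →
                        sumℚ (map f (tabulate Fin.suc)) ≡ sumℚ (map (f ∘ Fin.suc) (allFin k))
sumℚ-map-tabulate-suc f = cong sumℚ (trans (List.map-tabulate Fin.suc f) (sym (List.map-tabulate id (f ∘ Fin.suc))))

jsum-∷∷ : ∀ {m} (b : Vec ℕ (suc (suc m)) → ℚ) x y r →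
  jsum b (x ∷ y ∷ r) ≡ ifPos y ((natℚ x + 1ℚ) * b (suc x ∷ pred y ∷ r)) + jsum (b ∘ (x ∷_)) (y ∷ r)
jsum-∷∷ {m} b x y r = cong (ifPos y ((natℚ x + 1ℚ) * b (suc x ∷ pred y ∷ r)) +_) (sumℚ-map-tabulate-suc {m} _)

weight-tail : ∀ {m} j x (v : Vec ℕ m) {f : Vec ℕ (suc (suc m)) → ℚ} {b : Vec ℕ (suc m) → ℚ} →
  (∀ s → wsFrom j s ℕ.+ 1 ≡ wsFrom j (x ∷ v) → f (s ∷ʳ 0) ≡ b s) →
  (∀ s → wsFrom (suc j) s ℕ.+ 1 ≡ wsFrom (suc j) v → f (x ∷ (s ∷ʳ 0)) ≡ b (x ∷ s))
weight-tail j x v f≡b s e = f≡b (x ∷ s) (trans (ℕ.+-assoc (j ℕ.* x) _ 1) (cong (j ℕ.* x ℕ.+_) e))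

sumBy-preimages-∷ʳ0 : ∀ {m} j (v : Vec ℕ m) (f : Vec ℕ (suc m) → ℚ) (b : Vec ℕ m → ℚ) →
  (∀ s → wsFrom j s ℕ.+ 1 ≡ wsFrom j v → f (s ∷ʳ 0) ≡ b s) →
  sumBy (preimages (v ∷ʳ 0)) (λ (c , s) → c * f s) ≡ jsum b v
sumBy-preimages-∷ʳ0 j []       f b f≡b = refl
sumBy-preimages-∷ʳ0 j (x ∷ []) f b f≡b = refl
sumBy-preimages-∷ʳ0 j (x ∷ zero ∷ r) f b f≡b = begin
  sumBy (map (map₂ (x ∷_)) (preimages ((zero ∷ r) ∷ʳ 0))) (λ (c , s) → c * f s)
    ≡⟨ sumBy-map (map₂ (x ∷_)) (preimages ((zero ∷ r) ∷ʳ 0)) _ ⟩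
  sumBy (preimages ((zero ∷ r) ∷ʳ 0)) (λ (c , s) → c * f (x ∷ s))
    ≡⟨ sumBy-preimages-∷ʳ0 (suc j) (zero ∷ r) (f ∘ (x ∷_)) (b ∘ (x ∷_)) (weight-tail j x (zero ∷ r) {f} f≡b) ⟩
  jsum (b ∘ (x ∷_)) (zero ∷ r)
    ≡⟨ trans (jsum-∷∷ b x zero r) (ℚ.+-identityˡ _) ⟨
  jsum b (x ∷ zero ∷ r) ∎
  where open ≡-Reasoning
sumBy-preimages-∷ʳ0 j (x ∷ suc y ∷ r) f b f≡b = begin
  (natℚ x + 1ℚ) * f (suc x ∷ y ∷ (r ∷ʳ 0))
    + sumBy (map (map₂ (x ∷_)) (preimages ((suc y ∷ r) ∷ʳ 0))) (λ (c , s) → c * f s)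
    ≡⟨ cong₂ _+_ (cong ((natℚ x + 1ℚ) *_) (f≡b (suc x ∷ y ∷ r) weight))
         (trans (sumBy-map (map₂ (x ∷_)) (preimages ((suc y ∷ r) ∷ʳ 0)) _)
                (sumBy-preimages-∷ʳ0 (suc j) (suc y ∷ r) (f ∘ (x ∷_)) (b ∘ (x ∷_))
                                     (weight-tail j x (suc y ∷ r) {f} f≡b))) ⟩
  (natℚ x + 1ℚ) * b (suc x ∷ y ∷ r) + jsum (b ∘ (x ∷_)) (suc y ∷ r)
    ≡⟨ jsum-∷∷ b x (suc y) r ⟨
  jsum b (x ∷ suc y ∷ r) ∎
  where
  open ≡-Reasoning
  weight : wsFrom j (suc x ∷ y ∷ r) ℕ.+ 1 ≡ wsFrom j (x ∷ suc y ∷ r)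
  weight = solve 4 (λ j x y W → (j :* (con 1 :+ x) :+ ((con 1 :+ j) :* y :+ W)) :+ con 1
                                := j :* x :+ ((con 1 :+ j) :* (con 1 :+ y) :+ W)) refl j x y (wsFrom (suc (suc j)) r)
    where open ℕSolver.+-*-Solver

sumBy-preimages-last : ∀ l (f : Vec ℕ (suc (suc l)) → ℚ) →
  sumBy (preimages (0ᵛ {suc l} ∷ʳ 1)) (λ (c , s) → c * f s) ≡ f ((0ᵛ {l} ∷ʳ 1) ∷ʳ 0)
sumBy-preimages-last zero    f = trans (ℚ.+-identityʳ _) (ℚ.*-identityˡ _)
sumBy-preimages-last (suc l) f =
  trans (sumBy-map (map₂ (0 ∷_)) (preimages (0 ∷ (0ᵛ {l} ∷ʳ 1))) _) (sumBy-preimages-last l (f ∘ (0 ∷_)))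

module Coefficients (a : (n : ℕ) → Vec ℕ n → ℚ)
                    (S-δ≈ : ∀ k → S (δ k) ≈ expansion (suc k) (a (suc k))) where

  module Observed (m : ℕ) where
    open Corollas m

    coefficient : ∀ i → ws i ≡ suc m → a (suc m) i ≡ ⟨ S (δ m) , (λ u → indicator u i) ⟩
    coefficient i ws≡ = begin
      a (suc m) i
        ≡⟨ sumBy-tuples-indicator (suc m) (a (suc m)) i ws≡ ⟨
      sumBy (tuples (suc m)) (λ j → a (suc m) j * indicator j i)
        ≡⟨ sumBy-cong (tuples (suc m)) (λ j → cong (λ e → a (suc m) j * ev (λ u → indicator u i) e) (sym (monoExp-id j))) ⟩
      sumBy (tuples (suc m)) (λ j → a (suc m) j * ev (λ u → indicator u i) (monoExp 0 j))
        ≡⟨ ⟨expansion⟩ (suc m) (a (suc m)) (λ u → indicator u i) ⟨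
      ⟨ expansion (suc m) (a (suc m)) , (λ u → indicator u i) ⟩
        ≡⟨ ⟨⟩-resp-≈ (S (δ m)) (expansion (suc m) (a (suc m))) (S-δ≈ m) (λ u → indicator u i) ⟨
      ⟨ S (δ m) , (λ u → indicator u i) ⟩ ∎
      where open ≡-Reasoning

  module Step (k : ℕ) where
    open Corollas (suc k)
    open Observed (suc k)

    lower : ∀ g → ⟨ S (δ k) , g ⟩ ≡ sumBy (tuples (suc k)) (λ i → a (suc k) i * g (i ∷ʳ 0))
    lower g = trans (⟨⟩-resp-≈ (S (δ k)) (expansion (suc k) (a (suc k))) (S-δ≈ k) g)
      (trans (⟨expansion⟩ (suc k) (a (suc k)) g)
      (sumBy-cong (tuples (suc k)) (λ i → cong (λ e → a (suc k) i * ev g e) (monoExp-∷ʳ0 i))))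

    -- The coefficients a_{k+1}, indexed by exponents of length k + 2 with last entry 0.
    padded : Vec ℕ (suc (suc k)) → ℚ
    padded s = sumBy (tuples (suc k)) (λ i → a (suc k) i * indicator (i ∷ʳ 0) s)

    padded-∷ʳ0 : ∀ s → ws s ≡ suc k → padded (s ∷ʳ 0) ≡ a (suc k) s
    padded-∷ʳ0 s ws≡ = trans (sumBy-cong (tuples (suc k)) (λ i → cong (a (suc k) i *_) (indicator-∷ʳ0 i s)))
                        (sumBy-tuples-indicator (suc k) (a (suc k)) s ws≡)

    recursion : ∀ w → ws w ≡ suc (suc k) →
      a (suc (suc k)) w ≡ sumBy (preimages w) (λ (c , s) → c * padded s)
                          - natℚ (suc k) * sumBy (tuples (suc k)) (λ i → a (suc k) i * indicator (e₀ +ᵛ (i ∷ʳ 0)) w)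
    recursion w ws≡ = begin
      a (suc (suc k)) w
        ≡⟨ coefficient w ws≡ ⟩
      ⟨ S (δ (suc k)) , 𝟙 ⟩
        ≡⟨ ⟨S-δ-suc⟩ k 𝟙 ⟩
      ⟨ S (δ k) , graftDual 𝟙 ⟩ - natℚ (suc k) * ⟨ S (δ k) , leafDual 𝟙 ⟩
        ≡⟨ cong₂ (λ x y → x - natℚ (suc k) * y) (trans (lower (graftDual 𝟙)) graft-part) (lower (leafDual 𝟙)) ⟩
      sumBy (preimages w) (λ (c , s) → c * padded s)
        - natℚ (suc k) * sumBy (tuples (suc k)) (λ i → a (suc k) i * indicator (e₀ +ᵛ (i ∷ʳ 0)) w) ∎
      where
      open ≡-Reasoning
      𝟙 : Exponent → ℚ
      𝟙 u = indicator u w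
      graft-part : sumBy (tuples (suc k)) (λ i → a (suc k) i * graftDual 𝟙 (i ∷ʳ 0))
                   ≡ sumBy (preimages w) (λ (c , s) → c * padded s)
      graft-part = trans (sumBy-cong (tuples (suc k)) (λ i → cong (a (suc k) i *_) (graftDual-indicator w (i ∷ʳ 0))))
                         (sumBy-*-swap (tuples (suc k)) (preimages w) (a (suc k)) (λ i s → indicator (i ∷ʳ 0) s))

    leafDual-term : ∀ v → ws v ≡ suc (suc k) →
      sumBy (tuples (suc k)) (λ i → a (suc k) i * indicator (e₀ +ᵛ (i ∷ʳ 0)) (v ∷ʳ 0)) ≡ firstTerm (a (suc k)) v
    leafDual-term (zero  ∷ v) _   = sumBy-zero (tuples (suc k)) (λ { (y ∷ i) → ℚ.*-zeroʳ (a (suc k) (y ∷ i)) })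
    leafDual-term (suc x ∷ v) ws≡ =
      trans (sumBy-cong (tuples (suc k)) (λ { (y ∷ i) → cong (a (suc k) (y ∷ i) *_)
              (trans (cong (λ z → if y ℕ.≡ᵇ x then indicator z (v ∷ʳ 0) else 0ℚ) (+ᵛ-identityˡ (i ∷ʳ 0)))
                     (indicator-∷ʳ0 (y ∷ i) (x ∷ v))) }))
            (sumBy-tuples-indicator (suc k) (a (suc k)) (x ∷ v) (ℕ.suc-injective ws≡))

    a-∷ʳ0 : ∀ v → ws v ≡ suc (suc k) → a (suc (suc k)) (v ∷ʳ 0) ≡ recRHS (suc k) (a (suc k)) v
    a-∷ʳ0 v ws≡ = trans (recursion (v ∷ʳ 0) ws-v∷ʳ0)
      (cong₂ (λ x y → x - natℚ (suc k) * y)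
             (sumBy-preimages-∷ʳ0 1 v padded (a (suc k)) padded-lower) (leafDual-term v ws≡))
      where
      ws-v∷ʳ0 : ws (v ∷ʳ 0) ≡ suc (suc k)
      ws-v∷ʳ0 = trans (ws-∷ʳ0 v) ws≡
      padded-lower : ∀ s → ws s ℕ.+ 1 ≡ ws v → padded (s ∷ʳ 0) ≡ a (suc k) s
      padded-lower s e = padded-∷ʳ0 s (ℕ.suc-injective (trans (trans (ℕ.+-comm 1 (ws s)) e) ws≡))

    a-0ᵛ∷ʳ1-suc : a (suc (suc k)) (0ᵛ ∷ʳ 1) ≡ a (suc k) (0ᵛ ∷ʳ 1)
    a-0ᵛ∷ʳ1-suc = begin
      a (suc (suc k)) (0ᵛ ∷ʳ 1)
        ≡⟨ recursion (0ᵛ ∷ʳ 1) (ws-0ᵛ∷ʳ1 (suc k)) ⟩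
      sumBy (preimages (0ᵛ ∷ʳ 1)) (λ (c , s) → c * padded s) - natℚ (suc k) * leafSum
        ≡⟨ cong₂ (λ x y → x - natℚ (suc k) * y) (sumBy-preimages-last k padded) no-leaf ⟩
      padded ((0ᵛ ∷ʳ 1) ∷ʳ 0) - natℚ (suc k) * 0ℚ
        ≡⟨ cong (λ z → padded ((0ᵛ ∷ʳ 1) ∷ʳ 0) - z) (ℚ.*-zeroʳ (natℚ (suc k))) ⟩
      padded ((0ᵛ ∷ʳ 1) ∷ʳ 0) - 0ℚ
        ≡⟨ ℚ.+-identityʳ _ ⟩
      padded ((0ᵛ ∷ʳ 1) ∷ʳ 0)
        ≡⟨ padded-∷ʳ0 (0ᵛ ∷ʳ 1) (ws-0ᵛ∷ʳ1 k) ⟩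
      a (suc k) (0ᵛ ∷ʳ 1) ∎
      where
      open ≡-Reasoning
      leafSum : ℚ
      leafSum = sumBy (tuples (suc k)) (λ i → a (suc k) i * indicator (e₀ +ᵛ (i ∷ʳ 0)) (0ᵛ ∷ʳ 1))
      no-leaf : leafSum ≡ 0ℚ
      no-leaf = sumBy-zero (tuples (suc k)) (λ { (y ∷ i) → ℚ.*-zeroʳ (a (suc k) (y ∷ i)) })

  a-1 : a 1 (1 ∷ []) ≡ - 1ℚ
  a-1 = begin
    a 1 (1 ∷ [])                                  ≡⟨ coefficient (1 ∷ []) refl ⟩
    ⟨ S (δ 0) , (λ u → indicator u (1 ∷ [])) ⟩    ≡⟨ ⟨S⟩ (δ 0) (λ u → indicator u (1 ∷ [])) ⟩
    1ℚ * 𝒮 (leaf ∷ []) (λ u → indicator u (1 ∷ [])) + 0ℚ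
                                                  ≡⟨ cong (λ z → 1ℚ * z + 0ℚ) (𝒮-leaf (λ u → indicator u (1 ∷ []))) ⟩
    - 1ℚ                                          ∎
    where
    open ≡-Reasoning
    open Corollas 0
    open Observed 0

  a-0ᵛ∷ʳ1 : ∀ m → a (suc m) (0ᵛ ∷ʳ 1) ≡ - 1ℚ
  a-0ᵛ∷ʳ1 zero    = a-1
  a-0ᵛ∷ʳ1 (suc k) = trans (Step.a-0ᵛ∷ʳ1-suc k) (a-0ᵛ∷ʳ1 k)

  proposition2p1-∷ʳ : ∀ m (v : Vec ℕ m) z → ws (v ∷ʳ z) ≡ suc m →
    (z ≡ 1 → All (_≡ 0) v × a (suc m) (v ∷ʳ z) ≡ - 1ℚ) ×
    (z ≢ 1 → z ≡ 0 × a (suc m) (v ∷ʳ z) ≡ recRHS m (a m) v)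
  proposition2p1-∷ʳ m v z ws≡ = last-one , last-zero
    where
    weight : ws v ℕ.+ suc m ℕ.* z ≡ suc m
    weight = trans (sym (ws-∷ʳ v z)) ws≡
    last-one : z ≡ 1 → All (_≡ 0) v × a (suc m) (v ∷ʳ z) ≡ - 1ℚ
    last-one refl = v-zeros , trans (cong (λ u → a (suc m) (u ∷ʳ 1)) (zeros⇒0ᵛ v-zeros)) (a-0ᵛ∷ʳ1 m)
      where
      v-zeros : All (_≡ 0) v
      v-zeros = ws≡0⇒zeros v (ℕ.+-cancelʳ-≡ (suc m) (ws v) 0 (trans (cong (ws v ℕ.+_) (sym (ℕ.*-identityʳ (suc m)))) weight))
    last-zero : z ≢ 1 → z ≡ 0 × a (suc m) (v ∷ʳ z) ≡ recRHS m (a m) v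
    last-zero z≢1 with last-weight m (ws v) z weight z≢1
    ... | refl = refl , recursion-at m v (trans (sym (ws-∷ʳ0 v)) ws≡)
      where
      recursion-at : ∀ m (v : Vec ℕ m) → ws v ≡ suc m → a (suc m) (v ∷ʳ 0) ≡ recRHS m (a m) v
      recursion-at zero    [] ()
      recursion-at (suc k) v  ws≡ = Step.a-∷ʳ0 k v ws≡

proposition2p1 : (a : (n : ℕ) → Vec ℕ n → ℚ)
    → (∀ (k : ℕ) → S (δ k) ≈ expansion (suc k) (a (suc k)))
    → ∀ (m : ℕ) (i : Vec ℕ (suc m)) → ws i ≡ suc m
    → (last i ≡ 1 → All (_≡ 0) (init i) × a (suc m) i ≡ - 1ℚ)
      × (last i ≢ 1 → last i ≡ 0 × a (suc m) i ≡ recRHS m (a m) (init i))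
proposition2p1 a S-δ≈ m i ws≡ with initLast i
... | v , z , refl = Coefficients.proposition2p1-∷ʳ a S-δ≈ m v z ws≡
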